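{- Let $k\ge 3$ be an odd integer and let $g_k(z)=\sum_{n\ge1}\beta_k(n)q^n$ be as in the context. Then for any prime $p>2$ and integer $r\ge 1$, $$\beta_k(p)^r = \sum_{t=0}^{\lfloor \frac{r-1}{2} \rfloor} \binom{r}{t} p^{t(k-1)} \beta_{(r-2t)(k-1)+1}(p) + \begin{cases} \binom{r}{r/2} p^{\frac{r}{2}(k-1)}, & \text{if } p \equiv 1,3 \pmod 8 \text{ and } r \text{ even},\\ 0, & \text{otherwise}. \end{cases}$$ Also, $\beta_k(2)^r = \beta_{r(k-1)+1}(2)$.
   Context: For each odd integer $k\ge 3$, $g_k(z)=\sum_{n\ge1}\beta_k(n)q^n\in S_k(\Gamma_0(8),(\tfrac{ -8}{\cdot}))$ is a weight $k$ newform with complex multiplication by $\mathbb{Q}(\sqrt{ -2})$ whose coefficients at primes $p$ are: $\beta_k(p)=(c+d\sqrt{ -2})^{k-1}+(c-d\sqrt{ -2})^{k-1}$ if $p\equiv 1,3\pmod 8$, where $p=c^2+2d^2$ with integers $c,d$; $\beta_k(2)=(-2)^{(k-1)/2}$; and $\beta_k(p)=0$ otherwise. -}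

module Defs where

open import Data.Nat as ℕ using (ℕ; zero; suc; _∸_; _%_; ⌊_/2⌋; _≟_)
open import Data.Nat.Combinatorics using (_C_)
open import Data.Integer as ℤ using (ℤ; +_; -_)
open import Data.Product using (_×_; _,_; proj₁; proj₂)
open import Data.List using (List; []; _∷_; foldr; map; upTo; concatMap; filter)
open import Data.Bool using (Bool; true; false; if_then_else_; _∨_; _∧_)
open import Relation.Nullary.Decidable using (⌊_⌋; yes; no)

-- Elements a + b√-2 of ℤ[√-2], represented as pairs (a , b).
ℤ√-2 : Set
ℤ√-2 = ℤ × ℤ

_⊛_ : ℤ√-2 → ℤ√-2 → ℤ√-2
(a , b) ⊛ (c , d) = (a ℤ.* c ℤ.- + 2 ℤ.* (b ℤ.* d)) , (a ℤ.* d ℤ.+ b ℤ.* c)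

_^√_ : ℤ√-2 → ℕ → ℤ√-2
x ^√ zero = (+ 1 , + 0)
x ^√ suc n = x ⊛ (x ^√ n)

-- α^m + ᾱ^m = 2·Re(α^m) for α = c + d√-2.
traceP : ℤ√-2 → ℕ → ℤ
traceP x m = + 2 ℤ.* proj₁ (x ^√ m)

reps : ℕ → List (ℕ × ℕ)
reps p = filter (λ cd → proj₁ cd ℕ.* proj₁ cd ℕ.+ 2 ℕ.* (proj₂ cd ℕ.* proj₂ cd) ≟ p)
                (concatMap (λ c → map (λ d → (c , d)) (upTo (suc p))) (upTo (suc p)))

is13mod8 : ℕ → Bool
is13mod8 p = ⌊ p % 8 ≟ 1 ⌋ ∨ ⌊ p % 8 ≟ 3 ⌋

-- β_k(p) at primes p (the value at non-prime p is meaningless / unused):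
--  * p = 2 : (-2)^((k-1)/2)
--  * p ≡ 1,3 mod 8 : (c+d√-2)^(k-1) + (c-d√-2)^(k-1) where p = c² + 2d²
--  * otherwise 0.
β : ℕ → ℕ → ℤ
β k p with p ≟ 2
... | yes _ = (- (+ 2)) ℤ.^ ⌊ k ∸ 1 /2⌋
... | no _ with is13mod8 p | reps p
...   | true  | (c , d) ∷ _ = traceP (+ c , + d) (k ∸ 1)
...   | _     | _ = + 0

sumUpTo : ℕ → (ℕ → ℤ) → ℤ
sumUpTo n f = foldr (λ t acc → f t ℤ.+ acc) (+ 0) (upTo (suc n))

mainSum : ℕ → ℕ → ℕ → ℤ
mainSum k p r = sumUpTo ⌊ r ∸ 1 /2⌋ (λ t →
  + (r C t) ℤ.* (+ p) ℤ.^ (t ℕ.* (k ∸ 1)) ℤ.* β ((r ∸ 2 ℕ.* t) ℕ.* (k ∸ 1) ℕ.+ 1) p)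

extraTerm : ℕ → ℕ → ℕ → ℤ
extraTerm k p r =
  if is13mod8 p ∧ ⌊ r % 2 ≟ 0 ⌋
  then + (r C ⌊ r /2⌋) ℤ.* (+ p) ℤ.^ (⌊ r /2⌋ ℕ.* (k ∸ 1))
  else + 0

module Submission where

-- For an odd prime p ≡ 1, 3 (mod 8) write p = c² + 2d² and α = c + d√-2, so that αᾱ = p and
-- β_w(p) = α^(w-1) + ᾱ^(w-1) =: T_(w-1).  With m = k - 1, expanding T_m^r = (α^m + ᾱ^m)^r by the
-- binomial theorem and adding the terms of index t and r - t, which share the factor (α^m ᾱ^m)^t = p^(tm),
-- gives  T_m^r = Σ_{t ≤ (r-1)/2} C(r,t) p^(tm) T_((r-2t)m),  plus the unpaired middle term C(r,r/2) p^((r/2)m)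
-- when r is even.  For the other odd primes every β vanishes, and at p = 2 the identity is (-2)^(ab) = ((-2)^a)^b.

open import Defs
open import Data.Nat using (ℕ; _≤_; _<_; _%_; _∸_; _*_; _+_)
open import Data.Nat.Primality using (Prime)
open import Data.Integer as ℤ using (ℤ)
open import Data.Product using (_×_)
open import Relation.Binary.PropositionalEquality using (_≡_)

open import Data.Nat using (zero; suc; z≤n; s≤s; _!; _≟_; _<?_; ⌊_/2⌋)
import Data.Nat as ℕ
import Data.Nat.Properties as ℕP
import Data.Nat.Divisibility as ℕ∣
import Data.Nat.Tactic.RingSolver as ℕSolver
open import Data.Nat.Combinatorics using (_C_; nCk≡nC[n∸k])
open import Data.Nat.DivMod using (_/_; m≡m%n+[m/n]*n; m%n<n; [m+kn]%n≡m%n)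
open import Data.Nat.Coprimality using (prime⇒coprime; coprime-Bézout)
open import Data.Nat.GCD using (module Bézout)
open import Data.Nat.Primality using (euclidsLemma; prime⇒nonZero; prime⇒nonTrivial; prime⇒irreducible)
open import Data.Integer using (+_; -_)
import Data.Integer.Properties as ℤP
open import Data.Integer.DivMod using (_%ℕ_; _/ℕ_; a≡a%ℕn+[a/ℕn]*n; n%ℕd<d)
open import Data.Integer.Divisibility.Signed
  using (_∣_; _∣?_; divides; ∣ᵤ⇒∣; ∣⇒∣ᵤ; ∣m∣n⇒∣m+n; ∣m∣n⇒∣m-n; ∣m⇒∣-m; ∣n⇒∣m*n; ∣m⇒∣m*n)
open import Data.Integer.Tactic.RingSolver using (solve-∀)
open import Data.Fin using (Fin; toℕ; fromℕ<; remQuot; combine)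
import Data.Fin.Properties as FinP
open import Data.Bool using (Bool; true; false; if_then_else_)
open import Data.Bool.Properties using (∧-zeroʳ)
open import Data.List using (List; _∷_; foldr; map; upTo; applyUpTo; concatMap)
open import Data.List.Membership.Propositional using (_∈_; lose)
open import Data.List.Membership.Propositional.Properties using (∈-filter⁺; ∈-concatMap⁺; ∈-map⁺; ∈-upTo⁺)
open import Data.List.Relation.Unary.All using (All; _∷_)
open import Data.List.Relation.Unary.All.Properties using (all-filter)
open import Data.Empty using (⊥; ⊥-elim)
open import Data.Product using (_,_; ∃; proj₁; proj₂)
open import Data.Sum using (_⊎_; inj₁; inj₂)
open import Function using (_∘_; id)
open import Level using (0ℓ)
open import Relation.Nullary using (¬_; yes; no; Dec)
open import Relation.Nullary.Decidable using (⌊_⌋)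
import Relation.Binary.PropositionalEquality as ≡
open import Relation.Binary.PropositionalEquality.Algebra using (isMagma)
open import Algebra.Bundles using (CommutativeMonoid; CommutativeSemiring)
open import Algebra.Structures {A = ℤ√-2} _≡_ using (IsCommutativeMonoid)
open import Algebra.Structures.Biased {A = ℤ√-2} _≡_ using (isCommutativeMonoidˡ; IsCommutativeSemiringˡ)

complement-split : ∀ r t → t ℕ.+ t ℕ.≤ r → r ∸ t ≡ t ℕ.+ (r ∸ 2 ℕ.* t)
complement-split r t 2t≤r = begin
  r ∸ t                 ≡⟨ ≡.sym (ℕP.m+[n∸m]≡n (ℕP.m+n≤o⇒m≤o∸n t 2t≤r)) ⟩
  t ℕ.+ (r ∸ t ∸ t)     ≡⟨ ≡.cong (t ℕ.+_) (ℕP.∸-+-assoc r t t) ⟩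
  t ℕ.+ (r ∸ (t ℕ.+ t)) ≡⟨ ≡.cong (λ s → t ℕ.+ (r ∸ (t ℕ.+ s))) (≡.sym (ℕP.+-identityʳ t)) ⟩
  t ℕ.+ (r ∸ 2 ℕ.* t)   ∎
  where open ≡.≡-Reasoning

module FiniteSums {c ℓ} (M : CommutativeMonoid c ℓ) where
  open CommutativeMonoid M
  open import Relation.Binary.Reasoning.Setoid setoid
  open import Algebra.Definitions.RawMonoid rawMonoid using (sum)

  Σ< : ℕ → (ℕ → Carrier) → Carrier
  Σ< zero    f = ε
  Σ< (suc n) f = f 0 ∙ Σ< n (f ∘ suc)

  sum≡Σ< : ∀ n g → sum {n} (g ∘ toℕ) ≡ Σ< n g
  sum≡Σ< zero    g = ≡.refl
  sum≡Σ< (suc n) g = ≡.cong (g 0 ∙_) (sum≡Σ< n (g ∘ suc))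

  Σ<-cong : ∀ n {f g : ℕ → Carrier} → (∀ i → i < n → f i ≈ g i) → Σ< n f ≈ Σ< n g
  Σ<-cong zero    eq = refl
  Σ<-cong (suc n) eq = ∙-cong (eq 0 (s≤s z≤n)) (Σ<-cong n (λ i i<n → eq (suc i) (s≤s i<n)))

  Σ<-zero : ∀ n f → (∀ i → i < n → f i ≈ ε) → Σ< n f ≈ ε
  Σ<-zero n f f≈ε = trans (Σ<-cong n f≈ε) (all-ε n)
    where
    all-ε : ∀ n → Σ< n (λ _ → ε) ≈ ε
    all-ε zero    = refl
    all-ε (suc n) = trans (identityˡ _) (all-ε n)

  Σ<-split : ∀ m n f → Σ< (m ℕ.+ n) f ≈ Σ< m f ∙ Σ< n (λ i → f (m ℕ.+ i))
  Σ<-split zero    n f = sym (identityˡ _)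
  Σ<-split (suc m) n f = begin
    f 0 ∙ Σ< (m ℕ.+ n) (f ∘ suc)                          ≈⟨ ∙-congˡ (Σ<-split m n (f ∘ suc)) ⟩
    f 0 ∙ (Σ< m (f ∘ suc) ∙ Σ< n (λ i → f (suc m ℕ.+ i)))  ≈⟨ sym (assoc _ _ _) ⟩
    Σ< (suc m) f ∙ Σ< n (λ i → f (suc m ℕ.+ i))            ∎

  Σ<-last : ∀ n f → Σ< (suc n) f ≈ Σ< n f ∙ f n
  Σ<-last n f = begin
    Σ< (suc n) f               ≡⟨ ≡.cong (λ m → Σ< m f) (ℕP.+-comm 1 n) ⟩
    Σ< (n ℕ.+ 1) f             ≈⟨ Σ<-split n 1 f ⟩
    Σ< n f ∙ (f (n ℕ.+ 0) ∙ ε) ≈⟨ ∙-congˡ (identityʳ _) ⟩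
    Σ< n f ∙ f (n ℕ.+ 0)       ≡⟨ ≡.cong (λ i → Σ< n f ∙ f i) (ℕP.+-identityʳ n) ⟩
    Σ< n f ∙ f n               ∎

  Σ<-reverse : ∀ n f → Σ< n f ≈ Σ< n (λ i → f (n ∸ suc i))
  Σ<-reverse zero    f = refl
  Σ<-reverse (suc n) f = begin
    f 0 ∙ Σ< n (f ∘ suc)                   ≈⟨ ∙-congˡ (Σ<-reverse n (f ∘ suc)) ⟩
    f 0 ∙ Σ< n (λ i → f (suc (n ∸ suc i))) ≈⟨ ∙-congˡ (Σ<-cong n λ i i<n →
                                                 reflexive (≡.cong f (≡.sym (ℕP.+-∸-assoc 1 i<n)))) ⟩
    f 0 ∙ Σ< n (λ i → f (n ∸ i))           ≈⟨ comm _ _ ⟩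
    Σ< n (λ i → f (n ∸ i)) ∙ f 0           ≡⟨ ≡.cong (λ j → Σ< n (λ i → f (n ∸ i)) ∙ f j) (≡.sym (ℕP.n∸n≡0 n)) ⟩
    Σ< n (λ i → f (n ∸ i)) ∙ f (n ∸ n)     ≈⟨ sym (Σ<-last n (λ i → f (n ∸ i))) ⟩
    Σ< (suc n) (λ i → f (n ∸ i))           ∎

  Σ<-merge : ∀ n f g → Σ< n f ∙ Σ< n g ≈ Σ< n (λ i → f i ∙ g i)
  Σ<-merge zero    f g = identityˡ ε
  Σ<-merge (suc n) f g = begin
    (f 0 ∙ Σ< n (f ∘ suc)) ∙ (g 0 ∙ Σ< n (g ∘ suc)) ≈⟨ interchange _ _ _ _ ⟩
    (f 0 ∙ g 0) ∙ (Σ< n (f ∘ suc) ∙ Σ< n (g ∘ suc)) ≈⟨ ∙-congˡ (Σ<-merge n (f ∘ suc) (g ∘ suc)) ⟩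
    (f 0 ∙ g 0) ∙ Σ< n (λ i → f (suc i) ∙ g (suc i)) ∎
    where open import Algebra.Properties.CommutativeSemigroup commutativeSemigroup using (interchange)

  Σ<-fold-odd : ∀ h f → Σ< (suc (suc (h ℕ.+ h))) f ≈ Σ< (suc h) (λ t → f t ∙ f (suc (h ℕ.+ h) ∸ t))
  Σ<-fold-odd h f = begin
    Σ< (suc (suc (h ℕ.+ h))) f                                ≡⟨ ≡.cong (λ n → Σ< (suc n) f) (≡.sym (ℕP.+-suc h h)) ⟩
    Σ< (suc h ℕ.+ suc h) f                                    ≈⟨ Σ<-split (suc h) (suc h) f ⟩
    Σ< (suc h) f ∙ Σ< (suc h) (λ i → f (suc h ℕ.+ i))         ≈⟨ ∙-congˡ (Σ<-reverse (suc h) (λ i → f (suc h ℕ.+ i))) ⟩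
    Σ< (suc h) f ∙ Σ< (suc h) (λ i → f (suc h ℕ.+ (h ∸ i)))   ≈⟨ ∙-congˡ (Σ<-cong (suc h) λ i i<sh →
                                           reflexive (≡.cong f (≡.sym (ℕP.+-∸-assoc (suc h) (ℕP.≤-pred i<sh))))) ⟩
    Σ< (suc h) f ∙ Σ< (suc h) (λ i → f (suc (h ℕ.+ h) ∸ i))   ≈⟨ Σ<-merge (suc h) f (λ t → f (suc (h ℕ.+ h) ∸ t)) ⟩
    Σ< (suc h) (λ t → f t ∙ f (suc (h ℕ.+ h) ∸ t))            ∎

  Σ<-fold-even : ∀ h f → Σ< (suc (h ℕ.+ h)) f ≈ Σ< h (λ t → f t ∙ f (h ℕ.+ h ∸ t)) ∙ f h
  Σ<-fold-even h f = begin
    Σ< (suc (h ℕ.+ h)) f                                          ≡⟨ ≡.cong (λ n → Σ< n f) (≡.sym (ℕP.+-suc h h)) ⟩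
    Σ< (h ℕ.+ suc h) f                                            ≈⟨ Σ<-split h (suc h) f ⟩
    Σ< h f ∙ (f (h ℕ.+ 0) ∙ Σ< h (λ i → f (h ℕ.+ suc i)))         ≈⟨ ∙-congˡ (∙-cong (reflexive (≡.cong f (ℕP.+-identityʳ h)))
                                                                       (Σ<-reverse h (λ i → f (h ℕ.+ suc i)))) ⟩
    Σ< h f ∙ (f h ∙ Σ< h (λ i → f (h ℕ.+ suc (h ∸ suc i))))       ≈⟨ ∙-congˡ (∙-congˡ (Σ<-cong h λ i i<h →
                                                                       reflexive (≡.cong f (upper-index i i<h)))) ⟩
    Σ< h f ∙ (f h ∙ Σ< h (λ i → f (h ℕ.+ h ∸ i)))                 ≈⟨ ∙-congˡ (comm _ _) ⟩
    Σ< h f ∙ (Σ< h (λ i → f (h ℕ.+ h ∸ i)) ∙ f h)                 ≈⟨ sym (assoc _ _ _) ⟩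
    (Σ< h f ∙ Σ< h (λ i → f (h ℕ.+ h ∸ i))) ∙ f h                 ≈⟨ ∙-congʳ (Σ<-merge h f (λ t → f (h ℕ.+ h ∸ t))) ⟩
    Σ< h (λ t → f t ∙ f (h ℕ.+ h ∸ t)) ∙ f h                      ∎
    where
    upper-index : ∀ i → i < h → h ℕ.+ suc (h ∸ suc i) ≡ h ℕ.+ h ∸ i
    upper-index i i<h = ≡.trans (≡.cong (h ℕ.+_) (≡.sym (ℕP.+-∸-assoc 1 i<h)))
                                (≡.sym (ℕP.+-∸-assoc h (ℕP.<⇒≤ i<h)))

module BinomialPairing {c ℓ} (R : CommutativeSemiring c ℓ) where
  open CommutativeSemiring R renaming (_+_ to _⊕_; _*_ to _⊗_)
  open FiniteSums +-commutativeMonoid public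
  open import Relation.Binary.Reasoning.Setoid setoid
  open import Algebra.Definitions.RawMonoid +-rawMonoid using () renaming (_×_ to _·_)
  open import Algebra.Properties.CommutativeMonoid.Mult +-commutativeMonoid using (×-distrib-+; ×-congʳ)
  open import Algebra.Properties.Semiring.Exp semiring using (_^_; ^-homo-*)
  open import Algebra.Properties.CommutativeSemiring.Exp R using (^-distrib-*)
  import Algebra.Properties.CommutativeSemiring.Binomial R as Binomial

  module _ (x y : Carrier) where

    binomialTerm : ℕ → ℕ → Carrier
    binomialTerm n k = (n C k) · (x ^ k ⊗ y ^ (n ∸ k))

    pairedTerm : ℕ → ℕ → Carrier
    pairedTerm r t = (r C t) · ((x ⊗ y) ^ t ⊗ (x ^ (r ∸ 2 ℕ.* t) ⊕ y ^ (r ∸ 2 ℕ.* t)))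

    binomial : ∀ n → (x ⊕ y) ^ n ≈ Σ< (suc n) (binomialTerm n)
    binomial n = trans (Binomial.theorem n x y) (reflexive (sum≡Σ< (suc n) (binomialTerm n)))

    mirror-monomials : ∀ t j → x ^ t ⊗ y ^ (t ℕ.+ j) ⊕ x ^ (t ℕ.+ j) ⊗ y ^ t ≈ (x ⊗ y) ^ t ⊗ (x ^ j ⊕ y ^ j)
    mirror-monomials t j = begin
      x ^ t ⊗ y ^ (t ℕ.+ j) ⊕ x ^ (t ℕ.+ j) ⊗ y ^ t     ≈⟨ +-cong (*-congˡ (^-homo-* y t j)) (*-congʳ (^-homo-* x t j)) ⟩
      x ^ t ⊗ (y ^ t ⊗ y ^ j) ⊕ (x ^ t ⊗ x ^ j) ⊗ y ^ t ≈⟨ +-cong (sym (*-assoc _ _ _)) (*-assoc _ _ _) ⟩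
      (x ^ t ⊗ y ^ t) ⊗ y ^ j ⊕ x ^ t ⊗ (x ^ j ⊗ y ^ t) ≈⟨ +-congˡ (trans (*-congˡ (*-comm _ _)) (sym (*-assoc _ _ _))) ⟩
      (x ^ t ⊗ y ^ t) ⊗ y ^ j ⊕ (x ^ t ⊗ y ^ t) ⊗ x ^ j ≈⟨ sym (distribˡ _ _ _) ⟩
      (x ^ t ⊗ y ^ t) ⊗ (y ^ j ⊕ x ^ j)                 ≈⟨ *-cong (sym (^-distrib-* x y t)) (+-comm _ _) ⟩
      (x ⊗ y) ^ t ⊗ (x ^ j ⊕ y ^ j)                     ∎

    mirror-terms : ∀ r t → t ℕ.+ t ℕ.≤ r → binomialTerm r t ⊕ binomialTerm r (r ∸ t) ≈ pairedTerm r t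
    mirror-terms r t 2t≤r = begin
      (r C t) · (x ^ t ⊗ y ^ (r ∸ t)) ⊕ (r C (r ∸ t)) · (x ^ (r ∸ t) ⊗ y ^ (r ∸ (r ∸ t)))
        ≡⟨ ≡.cong₂ (λ a b → (r C t) · (x ^ t ⊗ y ^ a) ⊕ b) upper
             (≡.cong₂ (λ c e → c · (x ^ e ⊗ y ^ (r ∸ (r ∸ t)))) (≡.sym (nCk≡nC[n∸k] t≤r)) upper) ⟩
      (r C t) · (x ^ t ⊗ y ^ (t ℕ.+ j)) ⊕ (r C t) · (x ^ (t ℕ.+ j) ⊗ y ^ (r ∸ (r ∸ t)))
        ≡⟨ ≡.cong (λ e → (r C t) · (x ^ t ⊗ y ^ (t ℕ.+ j)) ⊕ (r C t) · (x ^ (t ℕ.+ j) ⊗ y ^ e)) (ℕP.m∸[m∸n]≡n t≤r) ⟩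
      (r C t) · (x ^ t ⊗ y ^ (t ℕ.+ j)) ⊕ (r C t) · (x ^ (t ℕ.+ j) ⊗ y ^ t)
        ≈⟨ sym (×-distrib-+ _ _ (r C t)) ⟩
      (r C t) · (x ^ t ⊗ y ^ (t ℕ.+ j) ⊕ x ^ (t ℕ.+ j) ⊗ y ^ t)
        ≈⟨ ×-congʳ (r C t) (mirror-monomials t j) ⟩
      pairedTerm r t ∎
      where
      j = r ∸ 2 ℕ.* t
      t≤r : t ℕ.≤ r
      t≤r = ℕP.≤-trans (ℕP.m≤m+n t t) 2t≤r
      upper : r ∸ t ≡ t ℕ.+ j
      upper = complement-split r t 2t≤r

    binomial-paired-odd : ∀ h → (x ⊕ y) ^ suc (h ℕ.+ h) ≈ Σ< (suc h) (pairedTerm (suc (h ℕ.+ h)))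
    binomial-paired-odd h = begin
      (x ⊕ y) ^ r                                             ≈⟨ binomial r ⟩
      Σ< (suc r) (binomialTerm r)                             ≈⟨ Σ<-fold-odd h (binomialTerm r) ⟩
      Σ< (suc h) (λ t → binomialTerm r t ⊕ binomialTerm r (r ∸ t)) ≈⟨ Σ<-cong (suc h) (λ t t<sh →
                                                                   mirror-terms r t (ℕP.m≤n⇒m≤1+n (ℕP.+-mono-≤ (ℕP.≤-pred t<sh) (ℕP.≤-pred t<sh)))) ⟩
      Σ< (suc h) (pairedTerm r)                               ∎
      where r = suc (h ℕ.+ h)

    binomial-paired-even : ∀ h → (x ⊕ y) ^ (h ℕ.+ h) ≈ Σ< h (pairedTerm (h ℕ.+ h)) ⊕ ((h ℕ.+ h) C h) · (x ⊗ y) ^ h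
    binomial-paired-even h = begin
      (x ⊕ y) ^ r                                                       ≈⟨ binomial r ⟩
      Σ< (suc r) (binomialTerm r)                                       ≈⟨ Σ<-fold-even h (binomialTerm r) ⟩
      Σ< h (λ t → binomialTerm r t ⊕ binomialTerm r (r ∸ t)) ⊕ binomialTerm r h
        ≈⟨ +-cong (Σ<-cong h (λ t t<h → mirror-terms r t (ℕP.+-mono-≤ (ℕP.<⇒≤ t<h) (ℕP.<⇒≤ t<h)))) middle ⟩
      Σ< h (pairedTerm r) ⊕ (r C h) · (x ⊗ y) ^ h                       ∎
      where
      r = h ℕ.+ h
      middle : binomialTerm r h ≈ (r C h) · (x ⊗ y) ^ h
      middle = ×-congʳ (r C h) (trans (reflexive (≡.cong (λ e → x ^ h ⊗ y ^ e) (ℕP.m+n∸m≡n h h)))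
                                      (sym (^-distrib-* x y h)))

module ℤΣ = FiniteSums ℤP.+-0-commutativeMonoid

open ≡ using (_≢_; refl; cong; cong₂; sym; trans; subst)

parity : ∀ n → ∃ λ h → n ≡ h ℕ.+ h ⊎ n ≡ suc (h ℕ.+ h)
parity zero    = 0 , inj₁ refl
parity (suc n) with parity n
... | h , inj₁ n≡h+h  = h , inj₂ (cong suc n≡h+h)
... | h , inj₂ n≡2h+1 = suc h , inj₁ (trans (cong suc n≡2h+1) (cong suc (sym (ℕP.+-suc h h))))

even%2 : ∀ h → (h ℕ.+ h) % 2 ≡ 0
even%2 h = trans (cong (_% 2) (twice h)) ([m+kn]%n≡m%n 0 h 2)
  where
  twice : ∀ h → h ℕ.+ h ≡ 0 ℕ.+ h ℕ.* 2
  twice = ℕSolver.solve-∀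

odd%2 : ∀ h → suc (h ℕ.+ h) % 2 ≡ 1
odd%2 h = trans (cong (_% 2) (twice+1 h)) ([m+kn]%n≡m%n 1 h 2)
  where
  twice+1 : ∀ h → suc (h ℕ.+ h) ≡ 1 ℕ.+ h ℕ.* 2
  twice+1 = ℕSolver.solve-∀

⌊1+h+h/2⌋≡h : ∀ h → ⌊ suc (h ℕ.+ h) /2⌋ ≡ h
⌊1+h+h/2⌋≡h zero    = refl
⌊1+h+h/2⌋≡h (suc h) = cong suc (trans (cong ⌊_/2⌋ (ℕP.+-suc h h)) (⌊1+h+h/2⌋≡h h))

odd≢even : ∀ a b → suc (a ℕ.+ a) ≢ b ℕ.+ b
odd≢even a b e = ℕP.1+n≢0 (trans (sym (odd%2 a)) (trans (cong (_% 2) e) (even%2 b)))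

-- The ring ℤ[√-2]: elements a + b√-2 are the pairs (a , b) of Defs, multiplied by _⊛_.
module ℤ[√-2] where

  infixl 6 _⊕_
  _⊕_ : ℤ√-2 → ℤ√-2 → ℤ√-2
  (a , b) ⊕ (c , d) = a ℤ.+ c , b ℤ.+ d

  𝟘 𝟙 : ℤ√-2
  𝟘 = + 0 , + 0
  𝟙 = + 1 , + 0

  ι : ℤ → ℤ√-2
  ι n = n , + 0

  conj : ℤ√-2 → ℤ√-2
  conj (a , b) = a , - b

  ⊕-isCommutativeMonoid : IsCommutativeMonoid _⊕_ 𝟘
  ⊕-isCommutativeMonoid = isCommutativeMonoidˡ record
    { isSemigroup = record { isMagma = isMagma _⊕_ ; assoc = λ where
        (a , b) (c , d) (e , f) → cong₂ _,_ (ℤP.+-assoc a c e) (ℤP.+-assoc b d f) }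
    ; identityˡ = λ where (a , b) → cong₂ _,_ (ℤP.+-identityˡ a) (ℤP.+-identityˡ b)
    ; comm = λ where (a , b) (c , d) → cong₂ _,_ (ℤP.+-comm a c) (ℤP.+-comm b d)
    }

  ⊛-isCommutativeMonoid : IsCommutativeMonoid _⊛_ 𝟙
  ⊛-isCommutativeMonoid = isCommutativeMonoidˡ record
    { isSemigroup = record { isMagma = isMagma _⊛_ ; assoc = λ where
        (a , b) (c , d) (e , f) → cong₂ _,_ (assoc-re a b c d e f) (assoc-im a b c d e f) }
    ; identityˡ = λ where (a , b) → cong₂ _,_ (identity-re a b) (identity-im a b)
    ; comm = λ where (a , b) (c , d) → cong₂ _,_ (comm-re a b c d) (comm-im a b c d)
    }
    where
    assoc-re : ∀ a b c d e f → (a ℤ.* c ℤ.- + 2 ℤ.* (b ℤ.* d)) ℤ.* e ℤ.- + 2 ℤ.* ((a ℤ.* d ℤ.+ b ℤ.* c) ℤ.* f)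
                             ≡ a ℤ.* (c ℤ.* e ℤ.- + 2 ℤ.* (d ℤ.* f)) ℤ.- + 2 ℤ.* (b ℤ.* (c ℤ.* f ℤ.+ d ℤ.* e))
    assoc-re = solve-∀
    assoc-im : ∀ a b c d e f → (a ℤ.* c ℤ.- + 2 ℤ.* (b ℤ.* d)) ℤ.* f ℤ.+ (a ℤ.* d ℤ.+ b ℤ.* c) ℤ.* e
                             ≡ a ℤ.* (c ℤ.* f ℤ.+ d ℤ.* e) ℤ.+ b ℤ.* (c ℤ.* e ℤ.- + 2 ℤ.* (d ℤ.* f))
    assoc-im = solve-∀
    identity-re : ∀ a b → + 1 ℤ.* a ℤ.- + 2 ℤ.* (+ 0 ℤ.* b) ≡ a
    identity-re = solve-∀
    identity-im : ∀ a b → + 1 ℤ.* b ℤ.+ + 0 ℤ.* a ≡ b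
    identity-im = solve-∀
    comm-re : ∀ a b c d → a ℤ.* c ℤ.- + 2 ℤ.* (b ℤ.* d) ≡ c ℤ.* a ℤ.- + 2 ℤ.* (d ℤ.* b)
    comm-re = solve-∀
    comm-im : ∀ a b c d → a ℤ.* d ℤ.+ b ℤ.* c ≡ c ℤ.* b ℤ.+ d ℤ.* a
    comm-im = solve-∀

  commutativeSemiring : CommutativeSemiring 0ℓ 0ℓ
  commutativeSemiring = record
    { isCommutativeSemiring = IsCommutativeSemiringˡ.isCommutativeSemiring record
      { +-isCommutativeMonoid = ⊕-isCommutativeMonoid
      ; *-isCommutativeMonoid = ⊛-isCommutativeMonoid
      ; distribʳ = λ where (a , b) (c , d) (e , f) → cong₂ _,_ (distrib-re a b c d e f) (distrib-im a b c d e f)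
      ; zeroˡ = λ where (a , b) → cong₂ _,_ (zero-re a b) (zero-im a b)
      }
    }
    where
    distrib-re : ∀ a b c d e f → (c ℤ.+ e) ℤ.* a ℤ.- + 2 ℤ.* ((d ℤ.+ f) ℤ.* b)
                               ≡ (c ℤ.* a ℤ.- + 2 ℤ.* (d ℤ.* b)) ℤ.+ (e ℤ.* a ℤ.- + 2 ℤ.* (f ℤ.* b))
    distrib-re = solve-∀
    distrib-im : ∀ a b c d e f → (c ℤ.+ e) ℤ.* b ℤ.+ (d ℤ.+ f) ℤ.* a
                               ≡ (c ℤ.* b ℤ.+ d ℤ.* a) ℤ.+ (e ℤ.* b ℤ.+ f ℤ.* a)
    distrib-im = solve-∀
    zero-re : ∀ a b → + 0 ℤ.* a ℤ.- + 2 ℤ.* (+ 0 ℤ.* b) ≡ + 0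
    zero-re = solve-∀
    zero-im : ∀ a b → + 0 ℤ.* b ℤ.+ + 0 ℤ.* a ≡ + 0
    zero-im = solve-∀

  open CommutativeSemiring commutativeSemiring using (semiring; +-rawMonoid)
  open import Algebra.Properties.Semiring.Exp semiring public using (_^_; ^-assocʳ)
  open import Algebra.Properties.CommutativeSemiring.Exp commutativeSemiring public using (^-distrib-*)
  open import Algebra.Definitions.RawMonoid +-rawMonoid public using () renaming (_×_ to _·_)

  ^√≡^ : ∀ x n → x ^√ n ≡ x ^ n
  ^√≡^ x zero    = refl
  ^√≡^ x (suc n) = cong (x ⊛_) (^√≡^ x n)

  ι-⊛ : ∀ a b → ι a ⊛ ι b ≡ ι (a ℤ.* b)
  ι-⊛ a b = cong₂ _,_ (re a b) (im a b)
    where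
    re : ∀ a b → a ℤ.* b ℤ.- + 2 ℤ.* (+ 0 ℤ.* + 0) ≡ a ℤ.* b
    re = solve-∀
    im : ∀ a b → a ℤ.* + 0 ℤ.+ + 0 ℤ.* b ≡ + 0
    im = solve-∀

  ι-^ : ∀ a n → ι a ^ n ≡ ι (a ℤ.^ n)
  ι-^ a zero    = refl
  ι-^ a (suc n) = trans (cong (ι a ⊛_) (ι-^ a n)) (ι-⊛ a (a ℤ.^ n))

  ·≡ι⊛ : ∀ n z → n · z ≡ ι (+ n) ⊛ z
  ·≡ι⊛ zero    (a , b) = cong₂ _,_ (sym (re a b)) (sym (im a b))
    where
    re : ∀ a b → + 0 ℤ.* a ℤ.- + 2 ℤ.* (+ 0 ℤ.* b) ≡ + 0
    re = solve-∀
    im : ∀ a b → + 0 ℤ.* b ℤ.+ + 0 ℤ.* a ≡ + 0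
    im = solve-∀
  ·≡ι⊛ (suc n) (a , b) = trans (cong ((a , b) ⊕_) (·≡ι⊛ n (a , b))) (cong₂ _,_ (re a b (+ n)) (im a b (+ n)))
    where
    re : ∀ a b n → a ℤ.+ (n ℤ.* a ℤ.- + 2 ℤ.* (+ 0 ℤ.* b)) ≡ (+ 1 ℤ.+ n) ℤ.* a ℤ.- + 2 ℤ.* (+ 0 ℤ.* b)
    re = solve-∀
    im : ∀ a b n → b ℤ.+ (n ℤ.* b ℤ.+ + 0 ℤ.* a) ≡ (+ 1 ℤ.+ n) ℤ.* b ℤ.+ + 0 ℤ.* a
    im = solve-∀

  conj-⊛ : ∀ x y → conj (x ⊛ y) ≡ conj x ⊛ conj y
  conj-⊛ (a , b) (c , d) = cong₂ _,_ (re a b c d) (im a b c d)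
    where
    re : ∀ a b c d → a ℤ.* c ℤ.- + 2 ℤ.* (b ℤ.* d) ≡ a ℤ.* c ℤ.- + 2 ℤ.* ((- b) ℤ.* (- d))
    re = solve-∀
    im : ∀ a b c d → - (a ℤ.* d ℤ.+ b ℤ.* c) ≡ a ℤ.* (- d) ℤ.+ (- b) ℤ.* c
    im = solve-∀

  conj-^ : ∀ x n → conj (x ^ n) ≡ conj x ^ n
  conj-^ x zero    = refl
  conj-^ x (suc n) = trans (conj-⊛ x (x ^ n)) (cong (conj x ⊛_) (conj-^ x n))

  ⊕-conj : ∀ x → x ⊕ conj x ≡ ι (+ 2 ℤ.* proj₁ x)
  ⊕-conj (a , b) = cong₂ _,_ (re a) (ℤP.+-inverseʳ b)
    where
    re : ∀ a → a ℤ.+ a ≡ + 2 ℤ.* a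
    re = solve-∀

  norm : ∀ a b → (a , b) ⊛ conj (a , b) ≡ ι (a ℤ.* a ℤ.+ + 2 ℤ.* (b ℤ.* b))
  norm a b = cong₂ _,_ (re a b) (im a b)
    where
    re : ∀ a b → a ℤ.* a ℤ.- + 2 ℤ.* (b ℤ.* (- b)) ≡ a ℤ.* a ℤ.+ + 2 ℤ.* (b ℤ.* b)
    re = solve-∀
    im : ∀ a b → a ℤ.* (- b) ℤ.+ b ℤ.* a ≡ + 0
    im = solve-∀

-- Let α ∈ ℤ[√-2] have norm N and put T_m = α^m + ᾱ^m (= traceP α m).
-- Expanding (α^m + ᾱ^m)^r by the paired binomial theorem and using α^m ᾱ^m = N^m gives
--   T_m^r = Σ_{t ≤ (r-1)/2} C(r,t) N^(tm) T_((r-2t)m)  (+ C(r,r/2) N^((r/2)m) if r is even).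
module TracePowers (α : ℤ√-2) (N : ℤ) (α-norm : α ⊛ ℤ[√-2].conj α ≡ ℤ[√-2].ι N) (m : ℕ) where
  open ℤ[√-2]
  open BinomialPairing commutativeSemiring using (Σ<; Σ<-cong; pairedTerm; binomial-paired-odd; binomial-paired-even)
  open ≡.≡-Reasoning

  A B : ℤ√-2
  A = α ^ m
  B = conj α ^ m

  traceTerm : ℕ → ℕ → ℤ
  traceTerm r t = + (r C t) ℤ.* N ℤ.^ (t ℕ.* m) ℤ.* traceP α ((r ∸ 2 ℕ.* t) ℕ.* m)

  AB^ : ∀ t → (A ⊛ B) ^ t ≡ ι (N ℤ.^ (t ℕ.* m))
  AB^ t = begin
    (A ⊛ B) ^ t                    ≡⟨ cong (_^ t) (sym (^-distrib-* α (conj α) m)) ⟩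
    ((α ⊛ conj α) ^ m) ^ t         ≡⟨ ^-assocʳ (α ⊛ conj α) m t ⟩
    (α ⊛ conj α) ^ (m ℕ.* t)       ≡⟨ cong₂ _^_ α-norm (ℕP.*-comm m t) ⟩
    ι N ^ (t ℕ.* m)                ≡⟨ ι-^ N (t ℕ.* m) ⟩
    ι (N ℤ.^ (t ℕ.* m))            ∎

  A^j⊕B^j : ∀ j → A ^ j ⊕ B ^ j ≡ ι (traceP α (j ℕ.* m))
  A^j⊕B^j j = begin
    A ^ j ⊕ B ^ j                      ≡⟨ cong (λ z → A ^ j ⊕ z ^ j) (sym (conj-^ α m)) ⟩
    A ^ j ⊕ conj A ^ j                 ≡⟨ cong (A ^ j ⊕_) (sym (conj-^ A j)) ⟩
    A ^ j ⊕ conj (A ^ j)               ≡⟨ ⊕-conj (A ^ j) ⟩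
    ι (+ 2 ℤ.* proj₁ (A ^ j))          ≡⟨ cong (λ z → ι (+ 2 ℤ.* proj₁ z)) (^-assocʳ α m j) ⟩
    ι (+ 2 ℤ.* proj₁ (α ^ (m ℕ.* j)))  ≡⟨ cong (λ e → ι (+ 2 ℤ.* proj₁ e)) (sym (^√≡^ α (m ℕ.* j))) ⟩
    ι (traceP α (m ℕ.* j))             ≡⟨ cong (ι ∘ traceP α) (ℕP.*-comm m j) ⟩
    ι (traceP α (j ℕ.* m))             ∎

  pairedTerm≡ι : ∀ r t → pairedTerm A B r t ≡ ι (traceTerm r t)
  pairedTerm≡ι r t = begin
    (r C t) · (((A ⊛ B) ^ t) ⊛ (A ^ j ⊕ B ^ j))              ≡⟨ ·≡ι⊛ (r C t) _ ⟩
    ι (+ (r C t)) ⊛ (((A ⊛ B) ^ t) ⊛ (A ^ j ⊕ B ^ j))        ≡⟨ cong₂ (λ u v → ι (+ (r C t)) ⊛ (u ⊛ v)) (AB^ t) (A^j⊕B^j j) ⟩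
    ι (+ (r C t)) ⊛ (ι (N ℤ.^ (t ℕ.* m)) ⊛ ι (traceP α (j ℕ.* m)))
      ≡⟨ cong (ι (+ (r C t)) ⊛_) (ι-⊛ (N ℤ.^ (t ℕ.* m)) (traceP α (j ℕ.* m))) ⟩
    ι (+ (r C t)) ⊛ ι (N ℤ.^ (t ℕ.* m) ℤ.* traceP α (j ℕ.* m))
      ≡⟨ ι-⊛ (+ (r C t)) (N ℤ.^ (t ℕ.* m) ℤ.* traceP α (j ℕ.* m)) ⟩
    ι (+ (r C t) ℤ.* (N ℤ.^ (t ℕ.* m) ℤ.* traceP α (j ℕ.* m)))
      ≡⟨ cong ι (sym (ℤP.*-assoc (+ (r C t)) (N ℤ.^ (t ℕ.* m)) (traceP α (j ℕ.* m)))) ⟩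
    ι (traceTerm r t) ∎
    where
    j : ℕ
    j = r ∸ 2 ℕ.* t

  ι-Σ< : ∀ n g → Σ< n (ι ∘ g) ≡ ι (ℤΣ.Σ< n g)
  ι-Σ< zero    g = refl
  ι-Σ< (suc n) g = cong (ι (g 0) ⊕_) (ι-Σ< n (g ∘ suc))

  trace^ : ∀ r → ι (traceP α m ℤ.^ r) ≡ (A ⊕ B) ^ r
  trace^ r = begin
    ι (traceP α m ℤ.^ r)  ≡⟨ sym (ι-^ (traceP α m) r) ⟩
    ι (traceP α m) ^ r    ≡⟨ cong (λ z → z ^ r) (sym (trans (A^j⊕B^j 1) (cong (ι ∘ traceP α) (ℕP.+-identityʳ m)))) ⟩
    (A ^ 1 ⊕ B ^ 1) ^ r   ≡⟨ cong₂ (λ u v → (u ⊕ v) ^ r) (^-identityʳ A) (^-identityʳ B) ⟩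
    (A ⊕ B) ^ r           ∎
    where
    ^-identityʳ : ∀ x → x ^ 1 ≡ x
    ^-identityʳ x = CommutativeSemiring.*-identityʳ commutativeSemiring x

  trace-power-odd : ∀ h → traceP α m ℤ.^ suc (h ℕ.+ h) ≡ ℤΣ.Σ< (suc h) (traceTerm (suc (h ℕ.+ h)))
  trace-power-odd h = cong proj₁ (begin
    ι (traceP α m ℤ.^ r)                   ≡⟨ trace^ r ⟩
    (A ⊕ B) ^ r                            ≡⟨ binomial-paired-odd A B h ⟩
    Σ< (suc h) (pairedTerm A B r)          ≡⟨ Σ<-cong (suc h) (λ t _ → pairedTerm≡ι r t) ⟩
    Σ< (suc h) (ι ∘ traceTerm r)           ≡⟨ ι-Σ< (suc h) (traceTerm r) ⟩
    ι (ℤΣ.Σ< (suc h) (traceTerm r))        ∎)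
    where
    r : ℕ
    r = suc (h ℕ.+ h)

  trace-power-even : ∀ h → traceP α m ℤ.^ (h ℕ.+ h)
                           ≡ ℤΣ.Σ< h (traceTerm (h ℕ.+ h)) ℤ.+ + ((h ℕ.+ h) C h) ℤ.* N ℤ.^ (h ℕ.* m)
  trace-power-even h = cong proj₁ (begin
    ι (traceP α m ℤ.^ r)                                         ≡⟨ trace^ r ⟩
    (A ⊕ B) ^ r                                                  ≡⟨ binomial-paired-even A B h ⟩
    Σ< h (pairedTerm A B r) ⊕ (r C h) · ((A ⊛ B) ^ h)              ≡⟨ cong₂ _⊕_ (Σ<-cong h (λ t _ → pairedTerm≡ι r t)) middle ⟩
    Σ< h (ι ∘ traceTerm r) ⊕ ι (+ (r C h) ℤ.* N ℤ.^ (h ℕ.* m))   ≡⟨ cong (_⊕ ι (+ (r C h) ℤ.* N ℤ.^ (h ℕ.* m))) (ι-Σ< h (traceTerm r)) ⟩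
    ι (ℤΣ.Σ< h (traceTerm r) ℤ.+ + (r C h) ℤ.* N ℤ.^ (h ℕ.* m))  ∎)
    where
    r : ℕ
    r = h ℕ.+ h
    middle : (r C h) · ((A ⊛ B) ^ h) ≡ ι (+ (r C h) ℤ.* N ℤ.^ (h ℕ.* m))
    middle = trans (·≡ι⊛ (r C h) _) (trans (cong (ι (+ (r C h)) ⊛_) (AB^ h)) (ι-⊛ (+ (r C h)) (N ℤ.^ (h ℕ.* m))))

module PrimeModulus (p : ℕ) (p-prime : Prime p) where

  P : ℤ
  P = + p

  instance
    p≢0 : ℕ.NonZero p
    p≢0 = prime⇒nonZero p-prime

  1<p : 1 < p
  1<p = ℕ.nonTrivial⇒n>1 p {{prime⇒nonTrivial p-prime}}

  multiple<p⇒0 : ∀ k → k < p → P ∣ + k → k ≡ 0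
  multiple<p⇒0 zero    _   _ = refl
  multiple<p⇒0 (suc k) k<p d = ⊥-elim (ℕP.<⇒≱ k<p (ℕ∣.∣⇒≤ (∣⇒∣ᵤ d)))

  euclid : ∀ a b → P ∣ a ℤ.* b → P ∣ a ⊎ P ∣ b
  euclid a b d with euclidsLemma ℤ.∣ a ∣ ℤ.∣ b ∣ p-prime (subst (p ℕ∣.∣_) (ℤP.abs-* a b) (∣⇒∣ᵤ d))
  ... | inj₁ p∣a = inj₁ (∣ᵤ⇒∣ p∣a)
  ... | inj₂ p∣b = inj₂ (∣ᵤ⇒∣ p∣b)

  private
    difference : ∀ j k → + (j ℕ.+ k) ℤ.- + j ≡ + k
    difference j k = trans (cong (ℤ._- + j) (ℤP.pos-+ j k)) (cancel (+ j) (+ k))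
      where
      cancel : ∀ a b → a ℤ.+ b ℤ.- a ≡ b
      cancel = solve-∀
    negate : ∀ a b → - (a ℤ.- b) ≡ b ℤ.- a
    negate = solve-∀

  cancel-factor : ∀ a b → ¬ (P ∣ b) → P ∣ a ℤ.* b → P ∣ a
  cancel-factor a b P∤b P∣ab with euclid a b P∣ab
  ... | inj₁ P∣a = P∣a
  ... | inj₂ P∣b = ⊥-elim (P∤b P∣b)

  residue-injective : ∀ i j → i < p → j < p → P ∣ + i ℤ.- + j → i ≡ j
  residue-injective i j i<p j<p d with ℕP.≤-total j i
  ... | inj₁ j≤i with ℕP.m≤n⇒∃[o]m+o≡n j≤i
  ...   | k , refl = trans (cong (j ℕ.+_) (multiple<p⇒0 k (ℕP.≤-<-trans (ℕP.m≤n+m k j) i<p)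
                                             (subst (P ∣_) (difference j k) d)))
                           (ℕP.+-identityʳ j)
  residue-injective i j i<p j<p d | inj₂ i≤j with ℕP.m≤n⇒∃[o]m+o≡n i≤j
  ...   | k , refl = sym (trans (cong (i ℕ.+_) (multiple<p⇒0 k (ℕP.≤-<-trans (ℕP.m≤n+m k i) j<p)
                                                  (subst (P ∣_) (trans (negate (+ i) (+ (i ℕ.+ k))) (difference i k)) (∣m⇒∣-m d))))
                                (ℕP.+-identityʳ i))

  cancel-unit : ∀ {a i j} c → 0 < a → a < p → i < p → j < p →
                P ∣ + i ℤ.* + a ℤ.- c → P ∣ + j ℤ.* + a ℤ.- c → i ≡ j
  cancel-unit {a} {i} {j} c 0<a a<p i<p j<p di dj
    with euclid (+ i ℤ.- + j) (+ a) (subst (P ∣_) (factor (+ i) (+ j) (+ a) c) (∣m∣n⇒∣m-n di dj))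
    where
    factor : ∀ i j a c → (i ℤ.* a ℤ.- c) ℤ.- (j ℤ.* a ℤ.- c) ≡ (i ℤ.- j) ℤ.* a
    factor = solve-∀
  ... | inj₁ P∣i-j = residue-injective i j i<p j<p P∣i-j
  ... | inj₂ P∣a   = ⊥-elim (ℕP.<-irrefl (sym (multiple<p⇒0 a a<p P∣a)) 0<a)

  inverse : ∀ i → 0 < i → i < p → ∃ λ u → P ∣ u ℤ.* + i ℤ.- + 1
  inverse (suc i) _ i<p with coprime-Bézout (prime⇒coprime p-prime i<p)
  ... | Bézout.+- x y 1+yi≡xp = - + y , divides (- + x) (trans (regroup (+ y) (+ suc i))
          (trans (cong -_ (lift 1+yi≡xp)) (neg-* (+ x) P)))
    where
    regroup : ∀ y i → (- y) ℤ.* i ℤ.- + 1 ≡ - (+ 1 ℤ.+ y ℤ.* i)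
    regroup = solve-∀
    neg-* : ∀ x P → - (x ℤ.* P) ≡ (- x) ℤ.* P
    neg-* = solve-∀
    lift : 1 ℕ.+ y ℕ.* suc i ≡ x ℕ.* p → + 1 ℤ.+ + y ℤ.* + suc i ≡ + x ℤ.* P
    lift e = trans (cong (λ z → + 1 ℤ.+ z) (sym (ℤP.pos-* y (suc i)))) (trans (cong +_ e) (ℤP.pos-* x p))
  ... | Bézout.-+ x y 1+xp≡yi = + y , divides (+ x) (trans (cong (ℤ._- + 1) (sym (lift 1+xp≡yi))) (cancel (+ x) P))
    where
    cancel : ∀ x P → + 1 ℤ.+ x ℤ.* P ℤ.- + 1 ≡ x ℤ.* P
    cancel = solve-∀
    lift : 1 ℕ.+ x ℕ.* p ≡ y ℕ.* suc i → + 1 ℤ.+ + x ℤ.* P ≡ + y ℤ.* + suc i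
    lift e = trans (cong (λ z → + 1 ℤ.+ z) (sym (ℤP.pos-* x p))) (trans (cong +_ e) (ℤP.pos-* y (suc i)))

  solve-linear : ∀ c i → 0 < i → i < p → ∃ λ j → j < p × P ∣ + i ℤ.* + j ℤ.- c
  solve-linear c i 0<i i<p with inverse i 0<i i<p
  ... | u , P∣ui-1 = j , n%ℕd<d (u ℤ.* c) p ,
        subst (P ∣_) (rearrange (+ i) (+ j) u c) (∣m∣n⇒∣m+n (∣n⇒∣m*n (+ i) (∣m⇒∣-m P∣uc-j)) (∣n⇒∣m*n c P∣ui-1))
    where
    j : ℕ
    j = (u ℤ.* c) %ℕ p
    P∣uc-j : P ∣ u ℤ.* c ℤ.- + j
    P∣uc-j = divides ((u ℤ.* c) /ℕ p)
      (trans (cong (ℤ._- + j) (a≡a%ℕn+[a/ℕn]*n (u ℤ.* c) p)) (cancel (+ j) ((u ℤ.* c) /ℕ p) P))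
      where
      cancel : ∀ j q P → j ℤ.+ q ℤ.* P ℤ.- j ≡ q ℤ.* P
      cancel = solve-∀
    rearrange : ∀ i j u c → i ℤ.* (- (u ℤ.* c ℤ.- j)) ℤ.+ c ℤ.* (u ℤ.* i ℤ.- + 1) ≡ i ℤ.* j ℤ.- c
    rearrange = solve-∀

  ∤-factorial : ∀ n → n < p → ¬ (P ∣ + (n !))
  ∤-factorial zero    _   d = ⊥-elim (ℕP.<-irrefl (sym (multiple<p⇒0 1 1<p d)) (s≤s z≤n))
  ∤-factorial (suc n) n<p d with euclid (+ suc n) (+ (n !)) (subst (P ∣_) (ℤP.pos-* (suc n) (n !)) d)
  ... | inj₁ p∣n+1 = ⊥-elim (ℕP.0≢1+n (sym (multiple<p⇒0 (suc n) n<p p∣n+1)))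
  ... | inj₂ p∣n!  = ∤-factorial n (ℕP.<-trans (ℕP.n<1+n n) n<p) p∣n!

stepProduct : ℤ → ℕ → ℤ
stepProduct x zero    = + 1
stepProduct x (suc n) = x ℤ.* stepProduct (x ℤ.- + 2) n

oddFactorial evenFactorial : ℕ → ℤ
oddFactorial  n = stepProduct (+ 2 ℤ.* + n ℤ.- + 1) n
evenFactorial n = stepProduct (+ 2 ℤ.* + n) n

stepProduct-+ : ∀ n a x → stepProduct x (n ℕ.+ a) ≡ stepProduct x n ℤ.* stepProduct (x ℤ.- + 2 ℤ.* + n) a
stepProduct-+ zero    a x = trans (cong (λ z → stepProduct z a) (shift0 x)) (sym (ℤP.*-identityˡ _))
  where
  shift0 : ∀ x → x ≡ x ℤ.- + 2 ℤ.* + 0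
  shift0 = solve-∀
stepProduct-+ (suc n) a x = trans (cong (x ℤ.*_) (stepProduct-+ n a (x ℤ.- + 2)))
  (trans (cong (λ z → x ℤ.* (stepProduct (x ℤ.- + 2) n ℤ.* stepProduct z a)) (shift (+ n) x))
         (sym (ℤP.*-assoc x _ _)))
  where
  shift : ∀ n x → x ℤ.- + 2 ℤ.- + 2 ℤ.* n ≡ x ℤ.- + 2 ℤ.* (+ 1 ℤ.+ n)
  shift = solve-∀

stepProduct-suc : ∀ n x → stepProduct x (suc n) ≡ stepProduct x n ℤ.* (x ℤ.- + 2 ℤ.* + n)
stepProduct-suc n x = trans (cong (stepProduct x) (ℕP.+-comm 1 n))
                            (trans (stepProduct-+ n 1 x) (cong (stepProduct x n ℤ.*_) (ℤP.*-identityʳ _)))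

stepProduct-shift : ∀ P y n → P ∣ stepProduct (P ℤ.+ y) n ℤ.- stepProduct y n
stepProduct-shift P y zero    = divides (+ 0) refl
stepProduct-shift P y (suc n) =
  subst (P ∣_) expand (∣m∣n⇒∣m+n (∣m⇒∣m*n a (divides (+ 1) (sym (ℤP.*-identityˡ P))))
                                 (∣n⇒∣m*n y (stepProduct-shift P (y ℤ.- + 2) n)))
  where
  a : ℤ
  a = stepProduct (P ℤ.+ (y ℤ.- + 2)) n
  regroup : ∀ P y a b → P ℤ.* a ℤ.+ y ℤ.* (a ℤ.- b) ≡ (P ℤ.+ y) ℤ.* a ℤ.- y ℤ.* b
  regroup = solve-∀
  reassoc : ∀ P y → P ℤ.+ (y ℤ.- + 2) ≡ P ℤ.+ y ℤ.- + 2
  reassoc = solve-∀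
  expand : P ℤ.* a ℤ.+ y ℤ.* (a ℤ.- stepProduct (y ℤ.- + 2) n)
         ≡ stepProduct (P ℤ.+ y) (suc n) ℤ.- stepProduct y (suc n)
  expand = trans (regroup P y a _)
                 (cong (λ z → (P ℤ.+ y) ℤ.* stepProduct z n ℤ.- y ℤ.* stepProduct (y ℤ.- + 2) n) (reassoc P y))

private
  pos-! : ∀ n → + (suc n !) ≡ + suc n ℤ.* + (n !)
  pos-! n = ℤP.pos-* (suc n) (n !)

stepProduct-−2 : ∀ n → stepProduct (- + 2) n ≡ (- + 2) ℤ.^ n ℤ.* + (n !)
stepProduct-−2 zero    = refl
stepProduct-−2 (suc n) = begin
  stepProduct (- + 2) (suc n)                                  ≡⟨ stepProduct-suc n (- + 2) ⟩
  stepProduct (- + 2) n ℤ.* (- + 2 ℤ.- + 2 ℤ.* + n)            ≡⟨ cong (ℤ._* (- + 2 ℤ.- + 2 ℤ.* + n)) (stepProduct-−2 n) ⟩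
  (- + 2) ℤ.^ n ℤ.* + (n !) ℤ.* (- + 2 ℤ.- + 2 ℤ.* + n)        ≡⟨ regroup ((- + 2) ℤ.^ n) (+ (n !)) (+ n) ⟩
  (- + 2) ℤ.^ suc n ℤ.* (+ suc n ℤ.* + (n !))                  ≡⟨ cong ((- + 2) ℤ.^ suc n ℤ.*_) (sym (pos-! n)) ⟩
  (- + 2) ℤ.^ suc n ℤ.* + (suc n !)                            ∎
  where
  open ≡.≡-Reasoning
  regroup : ∀ a b n → a ℤ.* b ℤ.* (- + 2 ℤ.- + 2 ℤ.* n) ≡ (- + 2 ℤ.* a) ℤ.* ((+ 1 ℤ.+ n) ℤ.* b)
  regroup = solve-∀

evenFactorial≡ : ∀ n → evenFactorial n ≡ (+ 2) ℤ.^ n ℤ.* + (n !)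
evenFactorial≡ zero    = refl
evenFactorial≡ (suc n) = begin
  + 2 ℤ.* + suc n ℤ.* stepProduct (+ 2 ℤ.* + suc n ℤ.- + 2) n  ≡⟨ cong (λ z → + 2 ℤ.* + suc n ℤ.* stepProduct z n) (lower (+ n)) ⟩
  + 2 ℤ.* + suc n ℤ.* evenFactorial n                         ≡⟨ cong (+ 2 ℤ.* + suc n ℤ.*_) (evenFactorial≡ n) ⟩
  + 2 ℤ.* + suc n ℤ.* ((+ 2) ℤ.^ n ℤ.* + (n !))                 ≡⟨ regroup ((+ 2) ℤ.^ n) (+ (n !)) (+ n) ⟩
  (+ 2) ℤ.^ suc n ℤ.* (+ suc n ℤ.* + (n !))                     ≡⟨ cong ((+ 2) ℤ.^ suc n ℤ.*_) (sym (pos-! n)) ⟩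
  (+ 2) ℤ.^ suc n ℤ.* + (suc n !)                               ∎
  where
  open ≡.≡-Reasoning
  lower : ∀ n → + 2 ℤ.* (+ 1 ℤ.+ n) ℤ.- + 2 ≡ + 2 ℤ.* n
  lower = solve-∀
  regroup : ∀ a b n → + 2 ℤ.* (+ 1 ℤ.+ n) ℤ.* (a ℤ.* b) ≡ (+ 2 ℤ.* a) ℤ.* ((+ 1 ℤ.+ n) ℤ.* b)
  regroup = solve-∀

oddFactorial-suc : ∀ n → oddFactorial (suc n) ≡ (+ 1 ℤ.+ + 2 ℤ.* + n) ℤ.* oddFactorial n
oddFactorial-suc n = cong₂ ℤ._*_ (top (+ n)) (cong (λ z → stepProduct z n) (next (+ n)))
  where
  top : ∀ n → + 2 ℤ.* (+ 1 ℤ.+ n) ℤ.- + 1 ≡ + 1 ℤ.+ + 2 ℤ.* n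
  top = solve-∀
  next : ∀ n → + 2 ℤ.* (+ 1 ℤ.+ n) ℤ.- + 1 ℤ.- + 2 ≡ + 2 ℤ.* n ℤ.- + 1
  next = solve-∀

factorial-even : ∀ n → + ((2 ℕ.* n) !) ≡ oddFactorial n ℤ.* evenFactorial n
factorial-odd  : ∀ n → + (suc (2 ℕ.* n) !) ≡ oddFactorial (suc n) ℤ.* evenFactorial n
factorial-even zero    = refl
factorial-even (suc n) = begin
  + ((2 ℕ.* suc n) !)                                          ≡⟨ cong (λ m → + (m !)) (ℕP.*-suc 2 n) ⟩
  + (suc (suc (2 ℕ.* n)) !)                                    ≡⟨ pos-! (suc (2 ℕ.* n)) ⟩
  + suc (suc (2 ℕ.* n)) ℤ.* + (suc (2 ℕ.* n) !)                ≡⟨ cong (+ suc (suc (2 ℕ.* n)) ℤ.*_) (factorial-odd n) ⟩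
  + suc (suc (2 ℕ.* n)) ℤ.* (O′ ℤ.* evenFactorial n)           ≡⟨ cong (λ z → (+ 2 ℤ.+ z) ℤ.* (O′ ℤ.* evenFactorial n)) (ℤP.pos-* 2 n) ⟩
  (+ 2 ℤ.+ + 2 ℤ.* + n) ℤ.* (O′ ℤ.* evenFactorial n)           ≡⟨ regroup (+ n) O′ (evenFactorial n) ⟩
  O′ ℤ.* ((+ 2 ℤ.* (+ 1 ℤ.+ + n)) ℤ.* evenFactorial n)         ≡⟨ cong (λ z → O′ ℤ.* ((+ 2 ℤ.* (+ 1 ℤ.+ + n)) ℤ.* stepProduct z n)) (sym (lower (+ n))) ⟩
  O′ ℤ.* evenFactorial (suc n)                                 ∎
  where
  open ≡.≡-Reasoning
  O′ : ℤ
  O′ = oddFactorial (suc n)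
  regroup : ∀ n O E → (+ 2 ℤ.+ + 2 ℤ.* n) ℤ.* (O ℤ.* E) ≡ O ℤ.* ((+ 2 ℤ.* (+ 1 ℤ.+ n)) ℤ.* E)
  regroup = solve-∀
  lower : ∀ n → + 2 ℤ.* (+ 1 ℤ.+ n) ℤ.- + 2 ≡ + 2 ℤ.* n
  lower = solve-∀
factorial-odd n = begin
  + (suc (2 ℕ.* n) !)                                          ≡⟨ pos-! (2 ℕ.* n) ⟩
  + suc (2 ℕ.* n) ℤ.* + ((2 ℕ.* n) !)                          ≡⟨ cong₂ (λ a b → (+ 1 ℤ.+ a) ℤ.* b) (ℤP.pos-* 2 n) (factorial-even n) ⟩
  (+ 1 ℤ.+ + 2 ℤ.* + n) ℤ.* (oddFactorial n ℤ.* evenFactorial n) ≡⟨ sym (ℤP.*-assoc (+ 1 ℤ.+ + 2 ℤ.* + n) (oddFactorial n) (evenFactorial n)) ⟩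
  (+ 1 ℤ.+ + 2 ℤ.* + n) ℤ.* oddFactorial n ℤ.* evenFactorial n  ≡⟨ cong (ℤ._* evenFactorial n) (sym (oddFactorial-suc n)) ⟩
  oddFactorial (suc n) ℤ.* evenFactorial n                     ∎
  where open ≡.≡-Reasoning

-- Gauss' computation of (-2)^h modulo P = 2h + 1.  Reducing every factor of (2h - 1)!! modulo P gives
--   (2h - 1)!! = (2h - 1)(2h - 3) ⋯ 1 ≡ (-2)(-4) ⋯ (-2h) = (-2)^h h!,
-- while if h = f + c with f even and h! = (2c - 1)!! (2f)!!, reducing only the first f factors gives
--   (2h - 1)!! = [(2h - 1) ⋯ (2c + 1)] (2c - 1)!! ≡ (-2)^f f! (2c - 1)!! = (2f)!! (2c - 1)!! = h!.
gauss-congruence : ∀ h f c q → h ≡ f ℕ.+ c → f ≡ 2 ℕ.* q → + (h !) ≡ oddFactorial c ℤ.* evenFactorial f →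
                   + suc (2 ℕ.* h) ∣ ((- + 2) ℤ.^ h ℤ.- + 1) ℤ.* + (h !)
gauss-congruence h f c q h≡f+c f≡2q h!≡ =
  subst (P ∣_) (difference (oddFactorial h) (+ (h !)) ((- + 2) ℤ.^ h)) (∣m∣n⇒∣m-n odd≡factorial odd≡power)
  where
  P : ℤ
  P = + suc (2 ℕ.* h)
  first : ℤ
  first = + 2 ℤ.* + h ℤ.- + 1
  first≡P-2 : first ≡ P ℤ.+ - + 2
  first≡P-2 = trans (rewrite-first (+ h)) (cong (λ z → (+ 1 ℤ.+ z) ℤ.+ - + 2) (sym (ℤP.pos-* 2 h)))
    where
    rewrite-first : ∀ h → + 2 ℤ.* h ℤ.- + 1 ≡ (+ 1 ℤ.+ + 2 ℤ.* h) ℤ.+ - + 2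
    rewrite-first = solve-∀
  odd≡power : P ∣ oddFactorial h ℤ.- (- + 2) ℤ.^ h ℤ.* + (h !)
  odd≡power = subst (P ∣_) (cong₂ ℤ._-_ (cong (λ z → stepProduct z h) (sym first≡P-2)) (stepProduct-−2 h))
                    (stepProduct-shift P (- + 2) h)
  odd-split : oddFactorial h ≡ stepProduct first f ℤ.* oddFactorial c
  odd-split = trans (cong (stepProduct first) h≡f+c) (trans (stepProduct-+ f c first)
    (cong (λ z → stepProduct first f ℤ.* stepProduct z c)
      (trans (cong (λ w → + 2 ℤ.* w ℤ.- + 1 ℤ.- + 2 ℤ.* + f) (trans (cong +_ h≡f+c) (ℤP.pos-+ f c)))
             (tail-start (+ f) (+ c)))))
    where
    tail-start : ∀ f c → + 2 ℤ.* (f ℤ.+ c) ℤ.- + 1 ℤ.- + 2 ℤ.* f ≡ + 2 ℤ.* c ℤ.- + 1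
    tail-start = solve-∀
  minus-even : stepProduct (- + 2) f ≡ evenFactorial f
  minus-even = trans (stepProduct-−2 f) (trans (cong (ℤ._* + (f !)) even-power) (sym (evenFactorial≡ f)))
    where
    even-power : (- + 2) ℤ.^ f ≡ (+ 2) ℤ.^ f
    even-power = begin
      (- + 2) ℤ.^ f         ≡⟨ cong ((- + 2) ℤ.^_) f≡2q ⟩
      (- + 2) ℤ.^ (2 ℕ.* q) ≡⟨ sym (ℤP.^-*-assoc (- + 2) 2 q) ⟩
      (+ 4) ℤ.^ q           ≡⟨ ℤP.^-*-assoc (+ 2) 2 q ⟩
      (+ 2) ℤ.^ (2 ℕ.* q)   ≡⟨ cong ((+ 2) ℤ.^_) (sym f≡2q) ⟩
      (+ 2) ℤ.^ f           ∎
      where open ≡.≡-Reasoning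
  odd≡factorial : P ∣ oddFactorial h ℤ.- + (h !)
  odd≡factorial = subst (P ∣_) regroup (∣m⇒∣m*n (oddFactorial c) (stepProduct-shift P (- + 2) f))
    where
    distrib : ∀ a b O → (a ℤ.- b) ℤ.* O ≡ a ℤ.* O ℤ.- b ℤ.* O
    distrib = solve-∀
    regroup : (stepProduct (P ℤ.+ - + 2) f ℤ.- stepProduct (- + 2) f) ℤ.* oddFactorial c ≡ oddFactorial h ℤ.- + (h !)
    regroup = trans (distrib (stepProduct (P ℤ.+ - + 2) f) (stepProduct (- + 2) f) (oddFactorial c))
      (cong₂ ℤ._-_ (trans (cong (λ z → stepProduct z f ℤ.* oddFactorial c) (sym first≡P-2)) (sym odd-split))
                   (trans (cong (ℤ._* oddFactorial c) minus-even)
                          (trans (ℤP.*-comm (evenFactorial f) (oddFactorial c)) (sym h!≡))))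
  difference : ∀ X F n → (X ℤ.- F) ℤ.- (X ℤ.- n ℤ.* F) ≡ (n ℤ.- + 1) ℤ.* F
  difference = solve-∀

gauss-data : ∀ p → is13mod8 p ≡ true →
             ∃ λ h → ∃ λ f → ∃ λ c → ∃ λ q → p ≡ suc (2 ℕ.* h) × h ≡ f ℕ.+ c × f ≡ 2 ℕ.* q
                                            × + (h !) ≡ oddFactorial c ℤ.* evenFactorial f
gauss-data p p≡1,3 with p ℕ.% 8 ≟ 1 | p ℕ.% 8 ≟ 3 | m≡m%n+[m/n]*n p 8
... | yes p%8≡1 | _ | p≡ = 2 ℕ.* f , f , f , q , trans p≡ (trans (cong (ℕ._+ q ℕ.* 8) p%8≡1) (class1 q))
                           , class1-h q , refl , factorial-even f
  where
  q f : ℕ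
  q = p / 8
  f = 2 ℕ.* q
  class1 : ∀ q → 1 ℕ.+ q ℕ.* 8 ≡ suc (2 ℕ.* (2 ℕ.* (2 ℕ.* q)))
  class1 = ℕSolver.solve-∀
  class1-h : ∀ q → 2 ℕ.* (2 ℕ.* q) ≡ 2 ℕ.* q ℕ.+ 2 ℕ.* q
  class1-h = ℕSolver.solve-∀
... | no _ | yes p%8≡3 | p≡ = suc (2 ℕ.* f) , f , suc f , q , trans p≡ (trans (cong (ℕ._+ q ℕ.* 8) p%8≡3) (class3 q))
                            , class3-h f , refl , factorial-odd f
  where
  q f : ℕ
  q = p / 8
  f = 2 ℕ.* q
  class3 : ∀ q → 3 ℕ.+ q ℕ.* 8 ≡ suc (2 ℕ.* suc (2 ℕ.* (2 ℕ.* q)))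
  class3 = ℕSolver.solve-∀
  class3-h : ∀ f → suc (2 ℕ.* f) ≡ f ℕ.+ suc f
  class3-h = ℕSolver.solve-∀
... | no _ | no _ | _ with p≡1,3
...   | ()

minus-two-power : ∀ p → Prime p → is13mod8 p ≡ true → ∃ λ h → p ≡ suc (2 ℕ.* h) × + p ∣ (- + 2) ℤ.^ h ℤ.- + 1
minus-two-power p p-prime p≡1,3 with gauss-data p p≡1,3
... | h , f , c , q , p≡2h+1 , h≡f+c , f≡2q , h!≡ =
  h , p≡2h+1 , cancel-factor ((- + 2) ℤ.^ h ℤ.- + 1) (+ (h !)) (∤-factorial h h<p) P∣product
  where
  open PrimeModulus p p-prime
  h<p : h < p
  h<p = subst (h <_) (sym p≡2h+1) (s≤s (ℕP.m≤m+n h (h ℕ.+ 0)))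
  P∣product : P ∣ ((- + 2) ℤ.^ h ℤ.- + 1) ℤ.* + (h !)
  P∣product = subst (λ n → + n ∣ ((- + 2) ℤ.^ h ℤ.- + 1) ℤ.* + (h !)) (sym p≡2h+1)
                    (gauss-congruence h f c q h≡f+c f≡2q h!≡)

Subset : Set
Subset = ℕ → Bool

size : ℕ → Subset → ℕ
size zero    S = 0
size (suc n) S = (if S n then 1 else 0) ℕ.+ size n S

product : ℕ → Subset → ℤ
product zero    S = + 1
product (suc n) S = (if S n then + n else + 1) ℤ.* product n S

_∖_ : Subset → ℕ → Subset
(S ∖ x) i = if ⌊ i ≟ x ⌋ then false else S i

∖-member⁻ : ∀ S x {i} → (S ∖ x) i ≡ true → S i ≡ true × i ≢ x
∖-member⁻ S x {i} e with i ≟ x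
... | no i≢x = e , i≢x

∖-member⁺ : ∀ S x {i} → S i ≡ true → i ≢ x → (S ∖ x) i ≡ true
∖-member⁺ S x {i} e i≢x with i ≟ x
... | yes i≡x = ⊥-elim (i≢x i≡x)
... | no _    = e

size-cong : ∀ n {S T} → (∀ i → i < n → S i ≡ T i) → size n S ≡ size n T
size-cong zero    eq = refl
size-cong (suc n) eq = cong₂ (λ b m → (if b then 1 else 0) ℕ.+ m) (eq n ℕP.≤-refl)
                             (size-cong n (λ i i<n → eq i (ℕP.m<n⇒m<1+n i<n)))

product-cong : ∀ n {S T} → (∀ i → i < n → S i ≡ T i) → product n S ≡ product n T
product-cong zero    eq = refl
product-cong (suc n) eq = cong₂ (λ b m → (if b then + n else + 1) ℤ.* m) (eq n ℕP.≤-refl)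
                                (product-cong n (λ i i<n → eq i (ℕP.m<n⇒m<1+n i<n)))

∖-agrees-below : ∀ S x n → n ≤ x → ∀ i → i < n → (S ∖ x) i ≡ S i
∖-agrees-below S x n n≤x i i<n with i ≟ x
... | yes refl = ⊥-elim (ℕP.<-irrefl refl (ℕP.<-≤-trans i<n n≤x))
... | no _     = refl

below-top : ∀ {x n} → x < suc n → n ≢ x → x < n
below-top x<n n≢x = ℕP.≤∧≢⇒< (ℕP.≤-pred x<n) (λ x≡n → n≢x (sym x≡n))

size-∖ : ∀ n S x → x < n → S x ≡ true → size n S ≡ suc (size n (S ∖ x))
size-∖ (suc n) S x x<n Sx with n ≟ x
... | yes refl rewrite Sx = cong suc (sym (size-cong n (∖-agrees-below S n n ℕP.≤-refl)))
... | no n≢x   = trans (cong ((if S n then 1 else 0) ℕ.+_) (size-∖ n S x (below-top x<n n≢x) Sx))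
                       (ℕP.+-suc _ _)

product-∖ : ∀ n S x → x < n → S x ≡ true → product n S ≡ + x ℤ.* product n (S ∖ x)
product-∖ (suc n) S x x<n Sx with n ≟ x
... | yes refl rewrite Sx = cong (+ n ℤ.*_) (trans (sym (product-cong n (∖-agrees-below S n n ℕP.≤-refl)))
                                                    (sym (ℤP.*-identityˡ _)))
... | no n≢x   = trans (cong ((if S n then + n else + 1) ℤ.*_) (product-∖ n S x (below-top x<n n≢x) Sx))
                       (swap (if S n then + n else + 1) (+ x) (product n (S ∖ x)))
  where
  swap : ∀ a b c → a ℤ.* (b ℤ.* c) ≡ b ℤ.* (a ℤ.* c)
  swap a b c = trans (sym (ℤP.*-assoc a b c)) (trans (cong (ℤ._* c) (ℤP.*-comm a b)) (ℤP.*-assoc b a c))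

empty-product : ∀ n S → size n S ≡ 0 → product n S ≡ + 1
empty-product zero    S _ = refl
empty-product (suc n) S e with S n
... | true  = ⊥-elim (ℕP.1+n≢0 e)
... | false = trans (ℤP.*-identityˡ (product n S)) (empty-product n S e)

nonempty : ∀ n S m → size n S ≡ suc m → ∃ λ x → x < n × S x ≡ true
nonempty (suc n) S m e with S n in Sn
... | true  = n , ℕP.≤-refl , Sn
... | false with nonempty n S m e
...   | x , x<n , Sx = x , ℕP.m<n⇒m<1+n x<n , Sx

module Pairing (p : ℕ) (p-prime : Prime p) (c : ℤ) (partner : ℕ → ℕ) where
  open PrimeModulus p p-prime

  record PairedSet (S : Subset) : Set where
    field
      range    : ∀ i → S i ≡ true → 0 < i × i < p
      closed   : ∀ i → S i ≡ true → S (partner i) ≡ true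
      distinct : ∀ i → S i ≡ true → partner i ≢ i
      pairs    : ∀ i → S i ≡ true → P ∣ + i ℤ.* + partner i ℤ.- c

  paired-product : ∀ k S → PairedSet S → size p S ≡ k ℕ.+ k → P ∣ product p S ℤ.- c ℤ.^ k
  paired-product zero S _ size≡0 =
    subst (λ z → P ∣ z ℤ.- + 1) (sym (empty-product p S size≡0)) (divides (+ 0) refl)
  paired-product (suc k) S H size≡ with nonempty p S (k ℕ.+ suc k) size≡
  ... | x , x<p , Sx = subst (P ∣_) product≡ (∣m∣n⇒∣m+n (∣m⇒∣m*n (+ x ℤ.* + y) IH) (∣n⇒∣m*n (c ℤ.^ k) (pairs x Sx)))
    where
    open PairedSet H
    y : ℕ
    y = partner x
    Sy : S y ≡ true
    Sy = closed x Sx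
    S∖x∋y : (S ∖ x) y ≡ true
    S∖x∋y = ∖-member⁺ S x Sy (distinct x Sx)
    S′ : Subset
    S′ = (S ∖ x) ∖ y

    -- partners of the remaining elements are neither x nor y, because partners are unique
    closed′ : ∀ z → S′ z ≡ true → S′ (partner z) ≡ true
    closed′ z S′z = ∖-member⁺ (S ∖ x) y (∖-member⁺ S x Sz′ z′≢x) z′≢y
      where
      Sz,z≢x : S z ≡ true × z ≢ x
      Sz,z≢x = ∖-member⁻ S x (proj₁ (∖-member⁻ (S ∖ x) y S′z))
      Sz : S z ≡ true
      Sz = proj₁ Sz,z≢x
      z≢y : z ≢ y
      z≢y = proj₂ (∖-member⁻ (S ∖ x) y S′z)
      Sz′ : S (partner z) ≡ true
      Sz′ = closed z Sz
      commute : ∀ {a b} → P ∣ + a ℤ.* + b ℤ.- c → P ∣ + b ℤ.* + a ℤ.- c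
      commute {a} {b} = subst (λ w → P ∣ w ℤ.- c) (ℤP.*-comm (+ a) (+ b))
      z′≢x : partner z ≢ x
      z′≢x z′≡x = z≢y (cancel-unit c (proj₁ (range x Sx)) x<p (proj₂ (range z Sz)) (proj₂ (range y Sy))
                          (subst (λ w → P ∣ + z ℤ.* + w ℤ.- c) z′≡x (pairs z Sz)) (commute {x} {y} (pairs x Sx)))
      z′≢y : partner z ≢ y
      z′≢y z′≡y = proj₂ Sz,z≢x (cancel-unit c (proj₁ (range y Sy)) (proj₂ (range y Sy)) (proj₂ (range z Sz)) x<p
                          (subst (λ w → P ∣ + z ℤ.* + w ℤ.- c) z′≡y (pairs z Sz)) (pairs x Sx))

    member : ∀ {z} → S′ z ≡ true → S z ≡ true
    member S′z = proj₁ (∖-member⁻ S x (proj₁ (∖-member⁻ (S ∖ x) y S′z)))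

    H′ : PairedSet S′
    H′ = record
      { range    = λ z S′z → range z (member S′z)
      ; closed   = closed′
      ; distinct = λ z S′z → distinct z (member S′z)
      ; pairs    = λ z S′z → pairs z (member S′z)
      }

    size′ : size p S′ ≡ k ℕ.+ k
    size′ = ℕP.suc-injective (ℕP.suc-injective (begin
      suc (suc (size p S′))    ≡⟨ cong suc (sym (size-∖ p (S ∖ x) y (proj₂ (range y Sy)) S∖x∋y)) ⟩
      suc (size p (S ∖ x))     ≡⟨ sym (size-∖ p S x x<p Sx) ⟩
      size p S                 ≡⟨ size≡ ⟩
      suc k ℕ.+ suc k          ≡⟨ cong suc (ℕP.+-suc k k) ⟩
      suc (suc (k ℕ.+ k))      ∎))
      where open ≡.≡-Reasoning

    IH : P ∣ product p S′ ℤ.- c ℤ.^ k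
    IH = paired-product k S′ H′ size′

    product≡ : (product p S′ ℤ.- c ℤ.^ k) ℤ.* (+ x ℤ.* + y) ℤ.+ c ℤ.^ k ℤ.* (+ x ℤ.* + y ℤ.- c)
             ≡ product p S ℤ.- c ℤ.^ suc k
    product≡ = trans (regroup (product p S′) c (c ℤ.^ k) (+ x) (+ y))
      (cong (ℤ._- c ℤ.* c ℤ.^ k) (sym (trans (product-∖ p S x x<p Sx)
                                       (cong (+ x ℤ.*_) (product-∖ p (S ∖ x) y (proj₂ (range y Sy)) S∖x∋y)))))
      where
      regroup : ∀ R c K x y → (R ℤ.- K) ℤ.* (x ℤ.* y) ℤ.+ K ℤ.* (x ℤ.* y ℤ.- c) ≡ x ℤ.* (y ℤ.* R) ℤ.- c ℤ.* K
      regroup = solve-∀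

module Residues (h : ℕ) (p-prime : Prime (suc (2 ℕ.* h))) where
  p : ℕ
  p = suc (2 ℕ.* h)

  open PrimeModulus p p-prime

  h′ : ℕ
  h′ = ℕ.pred h

  h≡suc-h′ : h ≡ suc h′
  h≡suc-h′ = positive h 1<p
    where
    positive : ∀ n → 1 < suc (2 ℕ.* n) → n ≡ suc (ℕ.pred n)
    positive zero    (s≤s ())
    positive (suc n) _ = refl

  2<p : 2 < p
  2<p = s≤s (ℕP.*-monoʳ-≤ 2 (subst (0 <_) (sym h≡suc-h′) (s≤s z≤n)))

  P∤1 : ¬ (P ∣ + 1)
  P∤1 P∣1 = ℕP.1+n≢0 (multiple<p⇒0 1 1<p P∣1)

  P∤2 : ¬ (P ∣ + 2)
  P∤2 P∣2 = ℕP.1+n≢0 (multiple<p⇒0 2 2<p P∣2)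

  units : Subset
  units i = if ⌊ i ≟ 0 ⌋ then false else ⌊ i <? p ⌋

  units-member : ∀ {i} → 0 < i → i < p → units i ≡ true
  units-member {i} 0<i i<p with i ≟ 0 | i <? p
  ... | yes refl | _      = ⊥-elim (ℕP.<-irrefl refl 0<i)
  ... | no _     | yes _  = refl
  ... | no _     | no i≮p = ⊥-elim (i≮p i<p)

  units-range : ∀ {i} → units i ≡ true → 0 < i × i < p
  units-range {i} e with i ≟ 0 | i <? p
  ... | no i≢0 | yes i<p = ℕP.n≢0⇒n>0 i≢0 , i<p

  size-units : ∀ n → n ≤ p → size n units ≡ n ∸ 1
  size-units zero          _   = refl
  size-units (suc zero)    _   = refl
  size-units (suc (suc n)) n<p =
    cong₂ (λ b m → (if b then 1 else 0) ℕ.+ m) (units-member (s≤s z≤n) n<p) (size-units (suc n) (ℕP.<⇒≤ n<p))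

  -- quotient c i is the residue j < p with i j ≡ c, for a unit i (and 0 otherwise)
  quotient : ℤ → ℕ → ℕ
  quotient c i with i ≟ 0 | i <? p
  ... | no i≢0 | yes i<p = proj₁ (solve-linear c i (ℕP.n≢0⇒n>0 i≢0) i<p)
  ... | _      | _       = 0

  quotient-spec : ∀ c {i} → 0 < i → i < p → quotient c i < p × P ∣ + i ℤ.* + quotient c i ℤ.- c
  quotient-spec c {i} 0<i i<p with i ≟ 0 | i <? p
  ... | no i≢0   | yes i<p′ = proj₂ (solve-linear c i (ℕP.n≢0⇒n>0 i≢0) i<p′)
  ... | yes refl | _        = ⊥-elim (ℕP.<-irrefl refl 0<i)
  ... | no _     | no i≮p   = ⊥-elim (i≮p i<p)

  quotient-positive : ∀ c {i} → ¬ (P ∣ c) → 0 < i → i < p → 0 < quotient c i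
  quotient-positive c {i} P∤c 0<i i<p with quotient c i | quotient-spec c 0<i i<p
  ... | zero  | _ , P∣0-c = ⊥-elim (P∤c (subst (P ∣_) (zero-quotient (+ i) c) (∣m⇒∣-m P∣0-c)))
    where
    zero-quotient : ∀ i c → - (i ℤ.* + 0 ℤ.- c) ≡ c
    zero-quotient = solve-∀
  ... | suc _ | _       = s≤s z≤n

  -- The units other than 1 and p - 1 = 2h; on them inversion is a fixed-point-free involution.
  rest : Subset
  rest = (units ∖ 1) ∖ (2 ℕ.* h)

  2h<p : 2 ℕ.* h < p
  2h<p = ℕP.n<1+n (2 ℕ.* h)

  units∋1 : units 1 ≡ true
  units∋1 = units-member (s≤s z≤n) 1<p

  units∖1∋2h : (units ∖ 1) (2 ℕ.* h) ≡ true
  units∖1∋2h = ∖-member⁺ units 1 (units-member (ℕP.<-trans (s≤s z≤n) 1<2h) 2h<p) (λ 2h≡1 → ℕP.<-irrefl (sym 2h≡1) 1<2h)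
    where
    1<2h : 1 < 2 ℕ.* h
    1<2h = ℕP.≤-pred 2<p

  rest-member : ∀ {i} → rest i ≡ true → 0 < i × suc i < p × i ≢ 1
  rest-member {i} e with ∖-member⁻ (units ∖ 1) (2 ℕ.* h) e
  ... | e′ , i≢2h with ∖-member⁻ units 1 e′
  ...   | ui , i≢1 = proj₁ (units-range ui) , ℕP.≤∧≢⇒< (proj₂ (units-range ui)) (λ si≡p → i≢2h (ℕP.suc-injective si≡p)) , i≢1

  rest-range : ∀ {i} → rest i ≡ true → 0 < i × i < p
  rest-range {i} e = proj₁ (rest-member {i} e) , ℕP.<-trans (ℕP.n<1+n i) (proj₁ (proj₂ (rest-member {i} e)))

  rest-≢1 : ∀ {i} → rest i ≡ true → ¬ (P ∣ + i ℤ.- + 1)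
  rest-≢1 {i} e P∣i-1 = proj₂ (proj₂ (rest-member {i} e)) (residue-injective i 1 (proj₂ (rest-range {i} e)) 1<p P∣i-1)

  rest-≢-1 : ∀ {i} → rest i ≡ true → ¬ (P ∣ + i ℤ.+ + 1)
  rest-≢-1 {i} e P∣i+1 = ℕP.1+n≢0 (multiple<p⇒0 (suc i) (proj₁ (proj₂ (rest-member {i} e)))
                                    (subst (P ∣_) (ℤP.+-comm (+ i) (+ 1)) P∣i+1))

  -- The inverse j of i ∈ rest is again in rest: j = 1 would give i ≡ 1, and j = p - 1 would give i ≡ -1.
  inverse-in-rest : ∀ i → rest i ≡ true → rest (quotient (+ 1) i) ≡ true
  inverse-in-rest i e = ∖-member⁺ (units ∖ 1) (2 ℕ.* h) (∖-member⁺ units 1 (units-member 0<j j<p) j≢1) j≢2h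
    where
    0<i : 0 < i
    0<i = proj₁ (rest-range {i} e)
    i<p : i < p
    i<p = proj₂ (rest-range {i} e)
    j : ℕ
    j = quotient (+ 1) i
    j<p : j < p
    j<p = proj₁ (quotient-spec (+ 1) 0<i i<p)
    ij≡1 : P ∣ + i ℤ.* + j ℤ.- + 1
    ij≡1 = proj₂ (quotient-spec (+ 1) 0<i i<p)
    0<j : 0 < j
    0<j = quotient-positive (+ 1) P∤1 0<i i<p
    j≢1 : j ≢ 1
    j≢1 j≡1 = rest-≢1 {i} e (subst (P ∣_) (trans (cong (λ n → + i ℤ.* + n ℤ.- + 1) j≡1) (times-one (+ i))) ij≡1)
      where
      times-one : ∀ i → i ℤ.* + 1 ℤ.- + 1 ≡ i ℤ.- + 1
      times-one = solve-∀
    j≢2h : j ≢ 2 ℕ.* h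
    j≢2h j≡2h = rest-≢-1 {i} e (subst (P ∣_) (minus-one (+ i) (+ (2 ℕ.* h)))
                  (∣m∣n⇒∣m-n (divides (+ i) refl) (subst (λ n → P ∣ + i ℤ.* + n ℤ.- + 1) j≡2h ij≡1)))
      where
      minus-one : ∀ i m → i ℤ.* (+ 1 ℤ.+ m) ℤ.- (i ℤ.* m ℤ.- + 1) ≡ i ℤ.+ + 1
      minus-one = solve-∀

  -- No i ∈ rest is its own inverse: i² ≡ 1 means (i - 1)(i + 1) ≡ 0.
  inverse-distinct : ∀ i → rest i ≡ true → quotient (+ 1) i ≢ i
  inverse-distinct i e j≡i with euclid (+ i ℤ.- + 1) (+ i ℤ.+ + 1) P∣i²-1
    where
    square-minus-one : ∀ i → i ℤ.* i ℤ.- + 1 ≡ (i ℤ.- + 1) ℤ.* (i ℤ.+ + 1)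
    square-minus-one = solve-∀
    P∣i²-1 : P ∣ (+ i ℤ.- + 1) ℤ.* (+ i ℤ.+ + 1)
    P∣i²-1 = subst (P ∣_) (square-minus-one (+ i))
               (subst (λ n → P ∣ + i ℤ.* + n ℤ.- + 1) j≡i (proj₂ (quotient-spec (+ 1) (proj₁ (rest-range {i} e)) (proj₂ (rest-range {i} e)))))
  ... | inj₁ P∣i-1 = rest-≢1 {i} e P∣i-1
  ... | inj₂ P∣i+1 = rest-≢-1 {i} e P∣i+1

  size-rest : size p rest ≡ h′ ℕ.+ h′
  size-rest = ℕP.suc-injective (ℕP.suc-injective (begin
    suc (suc (size p rest))   ≡⟨ cong suc (sym (size-∖ p (units ∖ 1) (2 ℕ.* h) 2h<p units∖1∋2h)) ⟩
    suc (size p (units ∖ 1))  ≡⟨ sym (size-∖ p units 1 1<p units∋1) ⟩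
    size p units              ≡⟨ size-units p ℕP.≤-refl ⟩
    2 ℕ.* h                   ≡⟨ cong (2 ℕ.*_) h≡suc-h′ ⟩
    2 ℕ.* suc h′              ≡⟨ double-suc h′ ⟩
    suc (suc (h′ ℕ.+ h′))     ∎))
    where
    open ≡.≡-Reasoning
    double-suc : ∀ n → 2 ℕ.* suc n ≡ suc (suc (n ℕ.+ n))
    double-suc = ℕSolver.solve-∀

  -- Wilson's theorem (p - 1)! ≡ -1: the units in rest multiply to 1, and 1 · (p - 1) ≡ -1.
  wilson : P ∣ product p units ℤ.+ + 1
  wilson = subst (P ∣_) wilson≡ (∣m∣n⇒∣m+n (∣n⇒∣m*n (+ (2 ℕ.* h)) P∣rest-1) (divides (+ 1) (sym (ℤP.*-identityˡ P))))
    where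
    open Pairing p p-prime (+ 1) (quotient (+ 1))
    rest-paired : PairedSet rest
    rest-paired = record
      { range    = λ i e → rest-range {i} e
      ; closed   = inverse-in-rest
      ; distinct = inverse-distinct
      ; pairs    = λ i e → proj₂ (quotient-spec (+ 1) (proj₁ (rest-range {i} e)) (proj₂ (rest-range {i} e)))
      }
    P∣rest-1 : P ∣ product p rest ℤ.- + 1
    P∣rest-1 = subst (λ z → P ∣ product p rest ℤ.- z) (ℤP.^-zeroˡ h′) (paired-product h′ rest rest-paired size-rest)
    wilson≡ : + (2 ℕ.* h) ℤ.* (product p rest ℤ.- + 1) ℤ.+ P ≡ product p units ℤ.+ + 1
    wilson≡ = trans (regroup (+ (2 ℕ.* h)) (product p rest))
      (cong (ℤ._+ + 1) (sym (trans (product-∖ p units 1 1<p units∋1)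
                                    (cong (+ 1 ℤ.*_) (product-∖ p (units ∖ 1) (2 ℕ.* h) 2h<p units∖1∋2h)))))
      where
      regroup : ∀ m R → m ℤ.* (R ℤ.- + 1) ℤ.+ (+ 1 ℤ.+ m) ≡ + 1 ℤ.* (m ℤ.* R) ℤ.+ + 1
      regroup = solve-∀

  -- If -2 is not a square mod p, pairing each unit i with -2 / i (never i itself) gives (p - 1)! ≡ (-2)^h.
  nonresidue-product : (∀ s → s < p → ¬ (P ∣ + s ℤ.* + s ℤ.+ + 2)) → P ∣ product p units ℤ.- (- + 2) ℤ.^ h
  nonresidue-product no-root = paired-product h units units-paired (trans (size-units p ℕP.≤-refl) (double h))
    where
    open Pairing p p-prime (- + 2) (quotient (- + 2))
    double : ∀ n → 2 ℕ.* n ≡ n ℕ.+ n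
    double = ℕSolver.solve-∀
    P∤-2 : ¬ (P ∣ - + 2)
    P∤-2 P∣-2 = P∤2 (∣m⇒∣-m P∣-2)
    units-paired : PairedSet units
    units-paired = record
      { range    = λ i e → units-range {i} e
      ; closed   = λ i e → let (0<i , i<p) = units-range {i} e in
                     units-member (quotient-positive (- + 2) P∤-2 0<i i<p) (proj₁ (quotient-spec (- + 2) 0<i i<p))
      ; distinct = λ i e j≡i → let (0<i , i<p) = units-range {i} e in
                     no-root i i<p (subst (P ∣_) (square-plus-two (+ i))
                       (subst (λ n → P ∣ + i ℤ.* + n ℤ.- - + 2) j≡i (proj₂ (quotient-spec (- + 2) 0<i i<p))))
      ; pairs    = λ i e → let (0<i , i<p) = units-range {i} e in proj₂ (quotient-spec (- + 2) 0<i i<p)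
      }
      where
      square-plus-two : ∀ i → i ℤ.* i ℤ.- - + 2 ≡ i ℤ.* i ℤ.+ + 2
      square-plus-two = solve-∀

  -- Euler's criterion for -2: if (-2)^h ≡ 1 (mod p) then -2 is a square modulo p.  Otherwise Wilson's
  -- theorem and nonresidue-product give (-2)^h ≡ -1, hence p ∣ 2.
  minus-two-square : P ∣ (- + 2) ℤ.^ h ℤ.- + 1 → ∃ λ s → P ∣ + s ℤ.* + s ℤ.+ + 2
  minus-two-square P∣power-1 with ℕP.anyUpTo? (λ s → P ∣? (+ s ℤ.* + s ℤ.+ + 2)) p
  ... | yes (s , _ , P∣s²+2) = s , P∣s²+2
  ... | no ∄root = ⊥-elim (P∤2 (subst (P ∣_) (two (product p units) ((- + 2) ℤ.^ h))
                    (∣m∣n⇒∣m-n (∣m∣n⇒∣m-n wilson (nonresidue-product no-root)) P∣power-1)))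
    where
    no-root : ∀ s → s < p → ¬ (P ∣ + s ℤ.* + s ℤ.+ + 2)
    no-root s s<p P∣ = ∄root (s , s<p , P∣)
    two : ∀ W X → (W ℤ.+ + 1) ℤ.- (W ℤ.- X) ℤ.- (X ℤ.- + 1) ≡ + 2
    two = solve-∀

integer-sqrt : ∀ n → ∃ λ m → m ℕ.* m ≤ n × n < suc m ℕ.* suc m
integer-sqrt zero = 0 , z≤n , s≤s z≤n
integer-sqrt (suc n) with integer-sqrt n
... | m , m²≤n , n<[m+1]² with ℕP.m≤n⇒m<n∨m≡n n<[m+1]²
...   | inj₁ n+1<[m+1]² = m , ℕP.m≤n⇒m≤1+n m²≤n , n+1<[m+1]²
...   | inj₂ n+1≡[m+1]² = suc m , ℕP.≤-reflexive (sym n+1≡[m+1]²) ,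
                          subst (_< suc (suc m) ℕ.* suc (suc m)) (sym n+1≡[m+1]²)
                                (ℕP.*-mono-< (ℕP.n<1+n (suc m)) (ℕP.n<1+n (suc m)))

-- Descent from a small multiple: if p ∣ x² + 2y² and 0 < x² + 2y² < 3p, then p = c² + 2d².
-- (Either x² + 2y² = p, or x² + 2y² = 2p, in which case x = 2u and p = y² + 2u².)
small-multiple : ∀ p x y → p ℕ∣.∣ x ℕ.* x ℕ.+ 2 ℕ.* (y ℕ.* y) →
                 0 < x ℕ.* x ℕ.+ 2 ℕ.* (y ℕ.* y) → x ℕ.* x ℕ.+ 2 ℕ.* (y ℕ.* y) < 3 ℕ.* p →
                 ∃ λ c → ∃ λ d → c ℕ.* c ℕ.+ 2 ℕ.* (d ℕ.* d) ≡ p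
small-multiple p x y (ℕ∣.divides zero K≡0) 0<K _ = ⊥-elim (ℕP.<-irrefl (sym K≡0) 0<K)
small-multiple p x y (ℕ∣.divides 1 K≡p) _ _ = x , y , trans K≡p (ℕP.*-identityˡ p)
small-multiple p x y (ℕ∣.divides 2 K≡2p) _ _ with parity x
... | u , inj₁ refl = y , u , ℕP.*-cancelˡ-≡ _ p 2 (trans (sym (halve u y)) K≡2p)
  where
  halve : ∀ u y → (u ℕ.+ u) ℕ.* (u ℕ.+ u) ℕ.+ 2 ℕ.* (y ℕ.* y) ≡ 2 ℕ.* (y ℕ.* y ℕ.+ 2 ℕ.* (u ℕ.* u))
  halve = ℕSolver.solve-∀
... | u , inj₂ refl = ⊥-elim (odd≢even (u ℕ.* (u ℕ.+ u) ℕ.+ (u ℕ.+ u) ℕ.+ y ℕ.* y) p (trans (odd-square u y) (trans K≡2p (double p))))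
  where
  odd-square : ∀ u y → suc (u ℕ.* (u ℕ.+ u) ℕ.+ (u ℕ.+ u) ℕ.+ y ℕ.* y ℕ.+ (u ℕ.* (u ℕ.+ u) ℕ.+ (u ℕ.+ u) ℕ.+ y ℕ.* y))
                     ≡ suc (u ℕ.+ u) ℕ.* suc (u ℕ.+ u) ℕ.+ 2 ℕ.* (y ℕ.* y)
  odd-square = ℕSolver.solve-∀
  double : ∀ p → 2 ℕ.* p ≡ p ℕ.+ p
  double = ℕSolver.solve-∀
small-multiple p x y (ℕ∣.divides (suc (suc (suc q))) K≡) _ K<3p =
  ⊥-elim (ℕP.<⇒≱ K<3p (ℕP.≤-trans (ℕP.*-monoˡ-≤ p {3} {suc (suc (suc q))} (s≤s (s≤s (s≤s z≤n)))) (ℕP.≤-reflexive (sym K≡))))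

distance : ∀ a b → ∃ λ t → a ≡ b ℕ.+ t ⊎ b ≡ a ℕ.+ t
distance a b with ℕP.≤-total b a
... | inj₁ b≤a = let (t , e) = ℕP.m≤n⇒∃[o]m+o≡n b≤a in t , inj₁ (sym e)
... | inj₂ a≤b = let (t , e) = ℕP.m≤n⇒∃[o]m+o≡n a≤b in t , inj₂ (sym e)

distance-square : ∀ a b t → (a ≡ b ℕ.+ t ⊎ b ≡ a ℕ.+ t) → (+ a ℤ.- + b) ℤ.* (+ a ℤ.- + b) ≡ + t ℤ.* + t
distance-square .(b ℕ.+ t) b t (inj₁ refl) rewrite ℤP.pos-+ b t = cancel (+ b) (+ t)
  where
  cancel : ∀ b t → (b ℤ.+ t ℤ.- b) ℤ.* (b ℤ.+ t ℤ.- b) ≡ t ℤ.* t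
  cancel = solve-∀
distance-square a .(a ℕ.+ t) t (inj₂ refl) rewrite ℤP.pos-+ a t = cancel (+ a) (+ t)
  where
  cancel : ∀ a t → (a ℤ.- (a ℤ.+ t)) ℤ.* (a ℤ.- (a ℤ.+ t)) ≡ t ℤ.* t
  cancel = solve-∀

distance-bound : ∀ a b t m → a ≤ m → b ≤ m → (a ≡ b ℕ.+ t ⊎ b ≡ a ℕ.+ t) → t ≤ m
distance-bound a b t m a≤m b≤m (inj₁ refl) = ℕP.≤-trans (ℕP.m≤n+m t b) a≤m
distance-bound a b t m a≤m b≤m (inj₂ refl) = ℕP.≤-trans (ℕP.m≤n+m t a) b≤m

distance-zero : ∀ a b → (a ≡ b ℕ.+ 0 ⊎ b ≡ a ℕ.+ 0) → a ≡ b
distance-zero a b (inj₁ e) = trans e (ℕP.+-identityʳ b)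
distance-zero a b (inj₂ e) = sym (trans e (ℕP.+-identityʳ a))

-- With m = ⌊√p⌋, the (m + 1)² > p numbers a + s b (0 ≤ a, b ≤ m) cannot be distinct mod p; two of them
-- agree, and the differences x = a₁ - a₂, y = b₁ - b₂ (not both 0, |x|, |y| ≤ m) satisfy
--   x² + 2y² = (x + s y)(x - s y) + y² (s² + 2) ≡ 0 (mod p)  and  0 < x² + 2y² ≤ 3m² < 3p.
module Thue (p : ℕ) (p-prime : Prime p) (s : ℕ) (P∣s²+2 : + p ∣ + s ℤ.* + s ℤ.+ + 2) where
  open PrimeModulus p p-prime

  m : ℕ
  m = proj₁ (integer-sqrt p)

  N : ℕ
  N = suc m

  -- m² < p because p is prime
  m²<p : m ℕ.* m < p
  m²<p = ℕP.≤∧≢⇒< (proj₁ (proj₂ (integer-sqrt p))) m²≢p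
    where
    m²≢p : m ℕ.* m ≢ p
    m²≢p e with prime⇒irreducible p-prime (ℕ∣.divides m (sym e))
    ... | inj₁ m≡1 = ℕP.<-irrefl (sym (trans (sym e) (cong (λ z → z ℕ.* z) m≡1))) 1<p
    ... | inj₂ m≡p = ℕP.<-irrefl refl (subst (1 <_) (ℕP.*-cancelˡ-≡ p 1 p (trans (trans (cong (λ z → z ℕ.* z) (sym m≡p)) e) (sym (ℕP.*-identityʳ p)))) 1<p)

  coordinates : Fin (N ℕ.* N) → ℕ × ℕ
  coordinates i = toℕ (proj₁ (remQuot {N} N i)) , toℕ (proj₂ (remQuot {N} N i))

  value : ℕ × ℕ → ℕ
  value (a , b) = a ℕ.+ s ℕ.* b

  residue : Fin (N ℕ.* N) → Fin p
  residue i = fromℕ< (m%n<n (value (coordinates i)) p)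

  coordinates-injective : ∀ i j → coordinates i ≡ coordinates j → i ≡ j
  coordinates-injective i j e = trans (sym (FinP.combine-remQuot {N} N i))
    (trans (cong (λ w → combine (proj₁ w) (proj₂ w))
                 (cong₂ _,_ (FinP.toℕ-injective (cong proj₁ e)) (FinP.toℕ-injective (cong proj₂ e))))
           (FinP.combine-remQuot {N} N j))

  coordinate≤m : ∀ i → proj₁ (coordinates i) ≤ m × proj₂ (coordinates i) ≤ m
  coordinate≤m i = ℕP.≤-pred (FinP.toℕ<n (proj₁ (remQuot {N} N i))) , ℕP.≤-pred (FinP.toℕ<n (proj₂ (remQuot {N} N i)))

  residue-congruence : ∀ i j → residue i ≡ residue j → P ∣ + value (coordinates i) ℤ.- + value (coordinates j)
  residue-congruence i j same = mod-equal (value (coordinates i)) (value (coordinates j))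
    (trans (sym (FinP.toℕ-fromℕ< (m%n<n (value (coordinates i)) p)))
           (trans (cong toℕ same) (FinP.toℕ-fromℕ< (m%n<n (value (coordinates j)) p))))
    where
    split : ∀ x → + x ≡ + (x % p) ℤ.+ + (x / p) ℤ.* P
    split x = trans (cong +_ (m≡m%n+[m/n]*n x p)) (trans (ℤP.pos-+ (x % p) _) (cong (λ z → + (x % p) ℤ.+ z) (ℤP.pos-* (x / p) p)))
    mod-equal : ∀ x y → x % p ≡ y % p → P ∣ + x ℤ.- + y
    mod-equal x y e = divides (+ (x / p) ℤ.- + (y / p))
      (trans (cong₂ ℤ._-_ (split x) (trans (split y) (cong (λ r → + r ℤ.+ + (y / p) ℤ.* P) (sym e))))
             (cancel (+ (x % p)) (+ (x / p)) (+ (y / p)) P))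
      where
      cancel : ∀ r X Y P → (r ℤ.+ X ℤ.* P) ℤ.- (r ℤ.+ Y ℤ.* P) ≡ (X ℤ.- Y) ℤ.* P
      cancel = solve-∀

  from-collision : ∀ i j → i ≢ j → residue i ≡ residue j → ∃ λ c → ∃ λ d → c ℕ.* c ℕ.+ 2 ℕ.* (d ℕ.* d) ≡ p
  from-collision i j i≢j same = small-multiple p tx ty (∣⇒∣ᵤ P∣K) 0<K K<3p
    where
    a₁ b₁ a₂ b₂ : ℕ
    a₁ = proj₁ (coordinates i)
    b₁ = proj₂ (coordinates i)
    a₂ = proj₁ (coordinates j)
    b₂ = proj₂ (coordinates j)
    dx : ∃ λ t → a₁ ≡ a₂ ℕ.+ t ⊎ a₂ ≡ a₁ ℕ.+ t
    dx = distance a₁ a₂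
    dy : ∃ λ t → b₁ ≡ b₂ ℕ.+ t ⊎ b₂ ≡ b₁ ℕ.+ t
    dy = distance b₁ b₂
    tx ty K : ℕ
    tx = proj₁ dx
    ty = proj₁ dy
    K = tx ℕ.* tx ℕ.+ 2 ℕ.* (ty ℕ.* ty)

    P∣difference : P ∣ (+ a₁ ℤ.+ + s ℤ.* + b₁) ℤ.- (+ a₂ ℤ.+ + s ℤ.* + b₂)
    P∣difference = subst (P ∣_) (cong₂ ℤ._-_ (lift a₁ b₁) (lift a₂ b₂)) (residue-congruence i j same)
      where
      lift : ∀ a b → + value (a , b) ≡ + a ℤ.+ + s ℤ.* + b
      lift a b = trans (ℤP.pos-+ a (s ℕ.* b)) (cong (λ z → + a ℤ.+ z) (ℤP.pos-* s b))

    P∣K : P ∣ + K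
    P∣K = subst (P ∣_) K≡ (∣m∣n⇒∣m+n (∣m⇒∣m*n ((+ a₁ ℤ.- + a₂) ℤ.- + s ℤ.* (+ b₁ ℤ.- + b₂)) P∣difference)
                                     (∣n⇒∣m*n ((+ b₁ ℤ.- + b₂) ℤ.* (+ b₁ ℤ.- + b₂)) P∣s²+2))
      where
      factor : ∀ a₁ a₂ b₁ b₂ s → ((a₁ ℤ.+ s ℤ.* b₁) ℤ.- (a₂ ℤ.+ s ℤ.* b₂)) ℤ.* ((a₁ ℤ.- a₂) ℤ.- s ℤ.* (b₁ ℤ.- b₂))
                                   ℤ.+ ((b₁ ℤ.- b₂) ℤ.* (b₁ ℤ.- b₂)) ℤ.* (s ℤ.* s ℤ.+ + 2)
                                 ≡ (a₁ ℤ.- a₂) ℤ.* (a₁ ℤ.- a₂) ℤ.+ + 2 ℤ.* ((b₁ ℤ.- b₂) ℤ.* (b₁ ℤ.- b₂))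
      factor = solve-∀
      K≡ : ((+ a₁ ℤ.+ + s ℤ.* + b₁) ℤ.- (+ a₂ ℤ.+ + s ℤ.* + b₂)) ℤ.* ((+ a₁ ℤ.- + a₂) ℤ.- + s ℤ.* (+ b₁ ℤ.- + b₂))
             ℤ.+ ((+ b₁ ℤ.- + b₂) ℤ.* (+ b₁ ℤ.- + b₂)) ℤ.* (+ s ℤ.* + s ℤ.+ + 2) ≡ + K
      K≡ = trans (factor (+ a₁) (+ a₂) (+ b₁) (+ b₂) (+ s))
             (trans (cong₂ (λ u v → u ℤ.+ + 2 ℤ.* v) (distance-square a₁ a₂ tx (proj₂ dx)) (distance-square b₁ b₂ ty (proj₂ dy)))
               (sym (trans (ℤP.pos-+ (tx ℕ.* tx) _)
                      (cong₂ ℤ._+_ (ℤP.pos-* tx tx) (trans (ℤP.pos-* 2 (ty ℕ.* ty)) (cong (λ z → + 2 ℤ.* z) (ℤP.pos-* ty ty)))))))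

    0<K : 0 < K
    0<K = positive tx ty (λ tx≡0 ty≡0 → i≢j (coordinates-injective i j (cong₂ _,_
            (distance-zero a₁ a₂ (subst (λ t → a₁ ≡ a₂ ℕ.+ t ⊎ a₂ ≡ a₁ ℕ.+ t) tx≡0 (proj₂ dx)))
            (distance-zero b₁ b₂ (subst (λ t → b₁ ≡ b₂ ℕ.+ t ⊎ b₂ ≡ b₁ ℕ.+ t) ty≡0 (proj₂ dy))))))
      where
      positive : ∀ x y → (x ≡ 0 → y ≡ 0 → ⊥) → 0 < x ℕ.* x ℕ.+ 2 ℕ.* (y ℕ.* y)
      positive zero    zero    both = ⊥-elim (both refl refl)
      positive (suc _) _       _    = s≤s z≤n
      positive zero    (suc _) _    = s≤s z≤n

    K<3p : K < 3 ℕ.* p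
    K<3p = ℕP.≤-<-trans (ℕP.≤-trans (ℕP.+-mono-≤ (ℕP.*-mono-≤ tx≤m tx≤m) (ℕP.*-monoʳ-≤ 2 (ℕP.*-mono-≤ ty≤m ty≤m)))
                                    (ℕP.≤-reflexive (three (m ℕ.* m))))
                        (ℕP.*-monoʳ-< 3 m²<p)
      where
      tx≤m : tx ≤ m
      tx≤m = distance-bound a₁ a₂ tx m (proj₁ (coordinate≤m i)) (proj₁ (coordinate≤m j)) (proj₂ dx)
      ty≤m : ty ≤ m
      ty≤m = distance-bound b₁ b₂ ty m (proj₂ (coordinate≤m i)) (proj₂ (coordinate≤m j)) (proj₂ dy)
      three : ∀ n → n ℕ.+ 2 ℕ.* n ≡ 3 ℕ.* n
      three = ℕSolver.solve-∀

  representation : ∃ λ c → ∃ λ d → c ℕ.* c ℕ.+ 2 ℕ.* (d ℕ.* d) ≡ p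
  representation with FinP.pigeonhole (proj₂ (proj₂ (integer-sqrt p))) residue
  ... | i , j , i<j , same = from-collision i j (λ i≡j → ℕP.<-irrefl (cong toℕ i≡j) i<j) same

-- Every prime p ≡ 1, 3 (mod 8) is of the form c² + 2d²: Gauss' computation gives (-2)^((p-1)/2) ≡ 1,
-- Euler's criterion turns this into a square root of -2, and Thue's lemma into the representation.
prime-representation : ∀ p → Prime p → is13mod8 p ≡ true → ∃ λ c → ∃ λ d → c ℕ.* c ℕ.+ 2 ℕ.* (d ℕ.* d) ≡ p
prime-representation p p-prime p≡1,3 = from-power (minus-two-power p p-prime p≡1,3)
  where
  from-power : (∃ λ h → p ≡ suc (2 ℕ.* h) × + p ∣ (- + 2) ℤ.^ h ℤ.- + 1) → ∃ λ c → ∃ λ d → c ℕ.* c ℕ.+ 2 ℕ.* (d ℕ.* d) ≡ p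
  from-power (h , refl , P∣power-1) =
    let (s , P∣s²+2) = Residues.minus-two-square h p-prime P∣power-1 in Thue.representation p p-prime s P∣s²+2

head-satisfies : ∀ {A : Set} {Q : A → Set} (xs : List A) {x} → All Q xs → x ∈ xs → ∃ λ y → ∃ λ ys → xs ≡ y ∷ ys × Q y
head-satisfies (y ∷ ys) (Qy ∷ _) _ = y , ys , refl , Qy

reps-head : ∀ p c d → c ℕ.* c ℕ.+ 2 ℕ.* (d ℕ.* d) ≡ p →
            ∃ λ cd → ∃ λ rest → reps p ≡ cd ∷ rest × proj₁ cd ℕ.* proj₁ cd ℕ.+ 2 ℕ.* (proj₂ cd ℕ.* proj₂ cd) ≡ p
reps-head p c d solution = head-satisfies (reps p) (all-filter solves? candidates) (∈-filter⁺ solves? candidate∈ solution)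
  where
  solves? : (cd : ℕ × ℕ) → Dec (proj₁ cd ℕ.* proj₁ cd ℕ.+ 2 ℕ.* (proj₂ cd ℕ.* proj₂ cd) ≡ p)
  solves? cd = proj₁ cd ℕ.* proj₁ cd ℕ.+ 2 ℕ.* (proj₂ cd ℕ.* proj₂ cd) ≟ p
  candidates : List (ℕ × ℕ)
  candidates = concatMap (λ c → map (λ d → (c , d)) (upTo (suc p))) (upTo (suc p))
  square-bound : ∀ n → n ≤ n ℕ.* n
  square-bound zero    = z≤n
  square-bound (suc n) = ℕP.m≤m*n (suc n) (suc n)
  c≤p : c ≤ p
  c≤p = ℕP.≤-trans (square-bound c) (subst (c ℕ.* c ≤_) solution (ℕP.m≤m+n (c ℕ.* c) (2 ℕ.* (d ℕ.* d))))
  d≤p : d ≤ p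
  d≤p = ℕP.≤-trans (square-bound d) (ℕP.≤-trans (ℕP.m≤m+n (d ℕ.* d) (d ℕ.* d ℕ.+ 0))
          (subst (2 ℕ.* (d ℕ.* d) ≤_) solution (ℕP.m≤n+m (2 ℕ.* (d ℕ.* d)) (c ℕ.* c))))
  candidate∈ : (c , d) ∈ candidates
  candidate∈ = ∈-concatMap⁺ (λ c → map (λ d → (c , d)) (upTo (suc p)))
                 (lose (∈-upTo⁺ (s≤s c≤p)) (∈-map⁺ (λ d → (c , d)) (∈-upTo⁺ (s≤s d≤p))))

β-trace : ∀ p → Prime p → 2 < p → is13mod8 p ≡ true →
          ∃ λ α → α ⊛ ℤ[√-2].conj α ≡ ℤ[√-2].ι (+ p) × (∀ w → β w p ≡ traceP α (w ∸ 1))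
β-trace p p-prime 2<p p≡1,3 =
  let (c₀ , d₀ , solution₀) = prime-representation p p-prime p≡1,3 in from-head (reps-head p c₀ d₀ solution₀)
  where
  from-head : (∃ λ cd → ∃ λ rest → reps p ≡ cd ∷ rest × proj₁ cd ℕ.* proj₁ cd ℕ.+ 2 ℕ.* (proj₂ cd ℕ.* proj₂ cd) ≡ p) →
              ∃ λ α → α ⊛ ℤ[√-2].conj α ≡ ℤ[√-2].ι (+ p) × (∀ w → β w p ≡ traceP α (w ∸ 1))
  from-head ((c , d) , rest , reps≡ , solution) = (+ c , + d) , norm≡p , β≡
    where
    norm≡p : (+ c , + d) ⊛ ℤ[√-2].conj (+ c , + d) ≡ ℤ[√-2].ι (+ p)
    norm≡p = trans (ℤ[√-2].norm (+ c) (+ d)) (cong ℤ[√-2].ι (trans lift (cong +_ solution)))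
      where
      lift : + c ℤ.* + c ℤ.+ + 2 ℤ.* (+ d ℤ.* + d) ≡ + (c ℕ.* c ℕ.+ 2 ℕ.* (d ℕ.* d))
      lift = sym (trans (ℤP.pos-+ (c ℕ.* c) _) (cong₂ ℤ._+_ (ℤP.pos-* c c)
                   (trans (ℤP.pos-* 2 (d ℕ.* d)) (cong (λ z → + 2 ℤ.* z) (ℤP.pos-* d d)))))
    β≡ : ∀ w → β w p ≡ traceP (+ c , + d) (w ∸ 1)
    β≡ w with p ≟ 2
    ... | yes p≡2 = ⊥-elim (ℕP.<-irrefl (sym p≡2) 2<p)
    ... | no _ rewrite p≡1,3 | reps≡ = refl

β-zero : ∀ p → 2 < p → is13mod8 p ≡ false → ∀ w → β w p ≡ + 0
β-zero p 2<p p≢1,3 w with p ≟ 2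
... | yes p≡2 = ⊥-elim (ℕP.<-irrefl (sym p≡2) 2<p)
... | no _ rewrite p≢1,3 = refl

sumUpTo≡Σ< : ∀ n f → sumUpTo n f ≡ ℤΣ.Σ< (suc n) f
sumUpTo≡Σ< n f = fold (suc n) id
  where
  fold : ∀ n g → foldr (λ t acc → f t ℤ.+ acc) (+ 0) (applyUpTo g n) ≡ ℤΣ.Σ< n (f ∘ g)
  fold zero    g = refl
  fold (suc n) g = cong (λ z → f (g 0) ℤ.+ z) (fold n (g ∘ suc))

extra-odd : ∀ k p h → extraTerm k p (suc (h ℕ.+ h)) ≡ + 0
extra-odd k p h rewrite odd%2 h | ∧-zeroʳ (is13mod8 p) = refl

extra-even : ∀ k p h → is13mod8 p ≡ true →
             extraTerm k p (h ℕ.+ h) ≡ + ((h ℕ.+ h) C h) ℤ.* (+ p) ℤ.^ (h ℕ.* (k ∸ 1))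
extra-even k p h p≡1,3 rewrite p≡1,3 | even%2 h | sym (ℕP.n≡⌊n+n/2⌋ h) = refl

module SplitPrime (k p : ℕ) (α : ℤ√-2) (α-norm : α ⊛ ℤ[√-2].conj α ≡ ℤ[√-2].ι (+ p))
                  (β≡ : ∀ w → β w p ≡ traceP α (w ∸ 1)) where
  open TracePowers α (+ p) α-norm (k ∸ 1)
  open ≡.≡-Reasoning

  mainSum≡ : ∀ r n → ⌊ r ∸ 1 /2⌋ ≡ n → mainSum k p r ≡ ℤΣ.Σ< (suc n) (traceTerm r)
  mainSum≡ r n half≡n = begin
    mainSum k p r                       ≡⟨ sumUpTo≡Σ< ⌊ r ∸ 1 /2⌋ summand ⟩
    ℤΣ.Σ< (suc ⌊ r ∸ 1 /2⌋) summand      ≡⟨ cong (λ n → ℤΣ.Σ< (suc n) summand) half≡n ⟩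
    ℤΣ.Σ< (suc n) summand               ≡⟨ ℤΣ.Σ<-cong (suc n) (λ t _ → summand≡ t) ⟩
    ℤΣ.Σ< (suc n) (traceTerm r)         ∎
    where
    summand : ℕ → ℤ
    summand t = + (r C t) ℤ.* (+ p) ℤ.^ (t ℕ.* (k ∸ 1)) ℤ.* β ((r ∸ 2 ℕ.* t) ℕ.* (k ∸ 1) ℕ.+ 1) p
    summand≡ : ∀ t → summand t ≡ traceTerm r t
    summand≡ t = cong (+ (r C t) ℤ.* (+ p) ℤ.^ (t ℕ.* (k ∸ 1)) ℤ.*_)
                      (trans (β≡ _) (cong (traceP α) (ℕP.m+n∸n≡m ((r ∸ 2 ℕ.* t) ℕ.* (k ∸ 1)) 1)))

  odd-power : ∀ h → β k p ℤ.^ suc (h ℕ.+ h) ≡ mainSum k p (suc (h ℕ.+ h)) ℤ.+ extraTerm k p (suc (h ℕ.+ h))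
  odd-power h = begin
    β k p ℤ.^ r                            ≡⟨ cong (ℤ._^ r) (β≡ k) ⟩
    traceP α (k ∸ 1) ℤ.^ r                 ≡⟨ trace-power-odd h ⟩
    ℤΣ.Σ< (suc h) (traceTerm r)            ≡⟨ sym (mainSum≡ r h (sym (ℕP.n≡⌊n+n/2⌋ h))) ⟩
    mainSum k p r                          ≡⟨ sym (ℤP.+-identityʳ (mainSum k p r)) ⟩
    mainSum k p r ℤ.+ + 0                  ≡⟨ cong (λ z → mainSum k p r ℤ.+ z) (sym (extra-odd k p h)) ⟩
    mainSum k p r ℤ.+ extraTerm k p r      ∎
    where
    r : ℕ
    r = suc (h ℕ.+ h)

  even-power : is13mod8 p ≡ true → ∀ h → β k p ℤ.^ (suc h ℕ.+ suc h)
               ≡ mainSum k p (suc h ℕ.+ suc h) ℤ.+ extraTerm k p (suc h ℕ.+ suc h)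
  even-power p≡1,3 h = begin
    β k p ℤ.^ r                                                    ≡⟨ cong (ℤ._^ r) (β≡ k) ⟩
    traceP α (k ∸ 1) ℤ.^ r                                         ≡⟨ trace-power-even (suc h) ⟩
    ℤΣ.Σ< (suc h) (traceTerm r) ℤ.+ middle                         ≡⟨ cong₂ ℤ._+_ (sym (mainSum≡ r h half≡h))
                                                                                  (sym (extra-even k p (suc h) p≡1,3)) ⟩
    mainSum k p r ℤ.+ extraTerm k p r                              ∎
    where
    r : ℕ
    r = suc h ℕ.+ suc h
    middle : ℤ
    middle = + (r C suc h) ℤ.* (+ p) ℤ.^ (suc h ℕ.* (k ∸ 1))
    half≡h : ⌊ r ∸ 1 /2⌋ ≡ h
    half≡h = trans (cong ⌊_/2⌋ (ℕP.+-suc h h)) (⌊1+h+h/2⌋≡h h)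

split-prime-case : ∀ k p r → Prime p → 2 < p → is13mod8 p ≡ true → 1 ≤ r →
                   β k p ℤ.^ r ≡ mainSum k p r ℤ.+ extraTerm k p r
split-prime-case k p r p-prime 2<p p≡1,3 = by-parity (β-trace p p-prime 2<p p≡1,3) r
  where
  by-parity : (∃ λ α → α ⊛ ℤ[√-2].conj α ≡ ℤ[√-2].ι (+ p) × (∀ w → β w p ≡ traceP α (w ∸ 1))) →
              ∀ r → 1 ≤ r → β k p ℤ.^ r ≡ mainSum k p r ℤ.+ extraTerm k p r
  by-parity (α , α-norm , β≡) r 1≤r with parity r
  ... | h     , inj₂ refl = SplitPrime.odd-power k p α α-norm β≡ h
  ... | suc h , inj₁ refl = SplitPrime.even-power k p α α-norm β≡ p≡1,3 h
  ... | zero  , inj₁ refl = ⊥-elim (ℕP.<-irrefl refl 1≤r)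

inert-prime-case : ∀ k p r → 2 < p → is13mod8 p ≡ false → 1 ≤ r →
                   β k p ℤ.^ r ≡ mainSum k p r ℤ.+ extraTerm k p r
inert-prime-case k p (suc r) 2<p p≢1,3 _ = begin
  β k p ℤ.* β k p ℤ.^ r                          ≡⟨ cong (ℤ._* β k p ℤ.^ r) (β-zero p 2<p p≢1,3 k) ⟩
  + 0 ℤ.* β k p ℤ.^ r                            ≡⟨ ℤP.*-zeroˡ (β k p ℤ.^ r) ⟩
  + 0                                            ≡⟨ sym (cong₂ ℤ._+_ mainSum≡0 extra≡0) ⟩
  mainSum k p (suc r) ℤ.+ extraTerm k p (suc r)  ∎
  where
  open ≡.≡-Reasoning
  summand : ℕ → ℤ
  summand t = + (suc r C t) ℤ.* (+ p) ℤ.^ (t ℕ.* (k ∸ 1)) ℤ.* β ((suc r ∸ 2 ℕ.* t) ℕ.* (k ∸ 1) ℕ.+ 1) p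
  summand≡0 : ∀ t → summand t ≡ + 0
  summand≡0 t = trans (cong (+ (suc r C t) ℤ.* (+ p) ℤ.^ (t ℕ.* (k ∸ 1)) ℤ.*_) (β-zero p 2<p p≢1,3 _))
                      (ℤP.*-zeroʳ (+ (suc r C t) ℤ.* (+ p) ℤ.^ (t ℕ.* (k ∸ 1))))
  mainSum≡0 : mainSum k p (suc r) ≡ + 0
  mainSum≡0 = trans (sumUpTo≡Σ< ⌊ r /2⌋ summand) (ℤΣ.Σ<-zero (suc ⌊ r /2⌋) summand (λ t _ → summand≡0 t))
  extra≡0 : extraTerm k p (suc r) ≡ + 0
  extra≡0 rewrite p≢1,3 = refl

-- The theorem at p = 2: β_k(2) = (-2)^((k-1)/2), and (k - 1)/2 · r = (r(k - 1))/2 for odd k.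
two-case : ∀ k → k ℕ.% 2 ≡ 1 → ∀ r → β k 2 ℤ.^ r ≡ β (r ℕ.* (k ∸ 1) ℕ.+ 1) 2
two-case k k-odd r with parity k
... | j , inj₁ refl = ⊥-elim (ℕP.0≢1+n (trans (sym (even%2 j)) k-odd))
... | j , inj₂ refl = begin
  ((- + 2) ℤ.^ ⌊ j ℕ.+ j /2⌋) ℤ.^ r              ≡⟨ cong (λ e → ((- + 2) ℤ.^ e) ℤ.^ r) (sym (ℕP.n≡⌊n+n/2⌋ j)) ⟩
  ((- + 2) ℤ.^ j) ℤ.^ r                         ≡⟨ ℤP.^-*-assoc (- + 2) j r ⟩
  (- + 2) ℤ.^ (j ℕ.* r)                         ≡⟨ cong ((- + 2) ℤ.^_) exponent ⟩
  (- + 2) ℤ.^ ⌊ r ℕ.* (j ℕ.+ j) ℕ.+ 1 ∸ 1 /2⌋    ∎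
  where
  open ≡.≡-Reasoning
  exponent : j ℕ.* r ≡ ⌊ r ℕ.* (j ℕ.+ j) ℕ.+ 1 ∸ 1 /2⌋
  exponent = begin
    j ℕ.* r                            ≡⟨ ℕP.n≡⌊n+n/2⌋ (j ℕ.* r) ⟩
    ⌊ j ℕ.* r ℕ.+ j ℕ.* r /2⌋            ≡⟨ cong ⌊_/2⌋ (double j r) ⟩
    ⌊ r ℕ.* (j ℕ.+ j) /2⌋                ≡⟨ cong ⌊_/2⌋ (sym (ℕP.m+n∸n≡m (r ℕ.* (j ℕ.+ j)) 1)) ⟩
    ⌊ r ℕ.* (j ℕ.+ j) ℕ.+ 1 ∸ 1 /2⌋      ∎
    where
    double : ∀ j r → j ℕ.* r ℕ.+ j ℕ.* r ≡ r ℕ.* (j ℕ.+ j)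
    double = ℕSolver.solve-∀

corollary1p6 : (k : ℕ) → 3 ≤ k → k % 2 ≡ 1 →
    ((p r : ℕ) → Prime p → 2 < p → 1 ≤ r →
      β k p ℤ.^ r ≡ mainSum k p r ℤ.+ extraTerm k p r)
    × ((r : ℕ) → 1 ≤ r → β k 2 ℤ.^ r ≡ β (r * (k ∸ 1) + 1) 2)
corollary1p6 k _ k-odd = odd-prime , λ r _ → two-case k k-odd r
  where
  odd-prime : (p r : ℕ) → Prime p → 2 < p → 1 ≤ r → β k p ℤ.^ r ≡ mainSum k p r ℤ.+ extraTerm k p r
  odd-prime p r p-prime 2<p 1≤r = by-class (is13mod8 p) refl
    where
    by-class : ∀ b → is13mod8 p ≡ b → β k p ℤ.^ r ≡ mainSum k p r ℤ.+ extraTerm k p r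
    by-class true  p≡1,3 = split-prime-case k p r p-prime 2<p p≡1,3 1≤r
    by-class false p≢1,3 = inert-prime-case k p r 2<p p≢1,3 1≤r
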